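{- Let $p \ge 5$ be prime, $G = C_3 \oplus C_{3p}$, $H_1 \cong C_3^2$ the subgroup of elements of order dividing $3$, $H_2 \cong C_p$ the subgroup of elements of order dividing $p$, so $G = H_1 \oplus H_2$, and let $\pi_1 : G \to H_1$ be the projection. Let $S$ be a squarefree sequence of length $3p+3$ over $G$, and for $h \in H_1$ let $S_h$ be the subsequence of terms $g$ of $S$ with $\pi_1(g) = h$, so $S = \prod_{h\in H_1} S_h$. (1) If there exist distinct $x,y,z \in H_1$ with $x+y+z = \pi_1(\sigma(S))$ such that $S_x, S_y, S_z$ are all nonempty and $|S_x|+|S_y|+|S_z| - 2 \ge p$, then $S$ has a subsequence of length $3p$ with sum $0$. (2) If there exist distinct $x,y \in H_1$ with $2x+y = \pi_1(\sigma(S))$ such that $|S_x| \ge 2$, $|S_y| \ge 1$ and $2|S_x| + |S_y| - 4 \ge p$, then $S$ has a subsequence of length $3p$ with sum $0$. (3) If there exists $x \in H_1$ with $3x = \pi_1(\sigma(S))$ such that $|S_x| \ge 3$ and $3|S_x| - 8 \ge p$, then $S$ has a subsequence of length $3p$ with sum $0$.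
   Context: A sequence over $G$ is a finite unordered list of elements of $G$; $|S|$ is its length; it is squarefree if its terms are distinct. $\sigma(S)$ is the sum of its terms. A subsequence is a sub-multiset. -}

module Defs where

open import Data.Nat using (ℕ; zero; suc; _+_; _*_; _<_)
open import Data.Nat.DivMod using (_%_)
open import Data.Nat.Properties using (_≟_)
open import Data.Product using (_×_; _,_; Σ; ∃)
open import Data.Product.Properties using (≡-dec)
open import Data.List using (List; []; _∷_; length; filter; foldr)
open import Relation.Binary.PropositionalEquality using (_≡_)
open import Relation.Nullary using (Dec)

-- reduction modulo m (m is always ≥ 3 in our use; m = 0 is a dummy case)
red : ℕ → ℕ → ℕ
red zero x = x
red (suc m) x = x % suc m

-- The group G = C₃ ⊕ C_{3p}, elements represented canonically by pairs (a , b)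
-- with a < 3 and b < 3p; addition is componentwise modular addition.
G : Set
G = ℕ × ℕ

Valid : ℕ → G → Set
Valid p (a , b) = (a < 3) × (b < 3 * p)

0G : G
0G = (0 , 0)

module Grp (p : ℕ) where
  infixl 6 _⊕_
  _⊕_ : G → G → G
  (a , b) ⊕ (c , d) = (red 3 (a + c) , red (3 * p) (b + d))

  _·_ : ℕ → G → G
  zero · g = 0G
  suc n · g = g ⊕ (n · g)

  σ : List G → G
  σ = foldr _⊕_ 0G

  InH1 : G → Set
  InH1 h = 3 · h ≡ 0G

  InH2 : G → Set
  InH2 h = p · h ≡ 0G

  IsProj1 : (G → G) → Set
  IsProj1 π = (g : G) → Valid p g →
    Valid p (π g) × InH1 (π g) × Σ G (λ k → Valid p k × InH2 k × (π g ⊕ k ≡ g))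

  fiber : (G → G) → G → List G → List G
  fiber π h S = filter (λ g → ≡-dec _≟_ _≟_ (π g) h) S

module Submission where

-- It suffices to find three distinct terms u, v, w of S lying over points
-- x₁, x₂, x₃ of H₁ with x₁ + x₂ + x₃ = π(σ S) whose H₂-components add up to that
-- of σ(S): then u + v + w = σ(S) and the other 3p terms sum to 0.  Terms over one
-- point of H₁ are determined by their H₂-component, a residue modulo p, so this is
-- a restricted sumset problem in ℤ/p: given sets A₁, A₂, A₃ of such residues and a
-- polynomial f, find (a, b, c) ∈ A₁ × A₂ × A₃ with a + b + c = t and f(a,b,c) ≠ 0.
-- It is solved by the polynomial method (Alon–Nathanson–Ruzsa), with f = 1 when
-- x₁, x₂, x₃ are distinct (Cauchy–Davenport), f = b - a when x₁ = x₂ ≠ x₃, and the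
-- Vandermonde (b - a)(c - a)(c - b) when x₁ = x₂ = x₃; the numerical hypotheses
-- are what is needed to choose |Aᵢ| = kᵢ + 1 with a non-vanishing coefficient.

module Congruences where
  open import Data.Nat as ℕ using (ℕ; NonZero; _<_; _≤_; _%_; _/_)
  import Data.Nat.Properties as ℕP
  import Data.Nat.DivMod as ℕDM
  import Data.Nat.Divisibility as ℕD
  open import Data.Integer using (ℤ; +_; _+_; _*_; -_; _-_; 0ℤ; ∣_∣)
  import Data.Integer.Properties as ℤP
  open import Data.Integer.Divisibility.Signed as ℤD using (divides; _∣_; ∣⇒∣ᵤ; ∣ᵤ⇒∣)
  open import Data.Integer.Tactic.RingSolver using (solve-∀)
  open import Data.Sum using (inj₁; inj₂)
  open import Function using (_$_)
  open import Relation.Binary.PropositionalEquality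
  open import Relation.Nullary using (Dec; contradiction)
  open import Relation.Nullary.Decidable using (map′)
  open import Relation.Binary.Bundles using (Setoid)

  -- Congruence of integers modulo a fixed natural number m, as a record so that
  -- m is always recoverable by the type checker.
  module Congruence (m : ℕ) where
    infix 4 _≈_
    record _≈_ (x y : ℤ) : Set where
      constructor mk≈
      field un≈ : (+ m) ∣ (x - y)
    open _≈_ public

    ≡⇒≈ : ∀ {x y} → x ≡ y → x ≈ y
    ≡⇒≈ {x} refl = mk≈ (divides 0ℤ (x-x≡0*m x (+ m)))
      where x-x≡0*m : ∀ x M → x - x ≡ 0ℤ * M
            x-x≡0*m = solve-∀

    ≈-refl : ∀ {x} → x ≈ x
    ≈-refl = ≡⇒≈ refl

    ≈-sym : ∀ {x y} → x ≈ y → y ≈ x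
    ≈-sym {x} {y} (mk≈ d) = mk≈ $ subst (_ ∣_) (neg-diff x y) (ℤD.∣m⇒∣-m d)
      where neg-diff : ∀ x y → - (x - y) ≡ y - x
            neg-diff = solve-∀

    ≈-trans : ∀ {x y z} → x ≈ y → y ≈ z → x ≈ z
    ≈-trans {x} {y} {z} (mk≈ d) (mk≈ e) = mk≈ $ subst (_ ∣_) (telescope x y z) (ℤD.∣m∣n⇒∣m+n d e)
      where telescope : ∀ x y z → (x - y) + (y - z) ≡ x - z
            telescope = solve-∀

    +-cong : ∀ {x x' y y'} → x ≈ x' → y ≈ y' → x + y ≈ x' + y'
    +-cong {x} {x'} {y} {y'} (mk≈ d) (mk≈ e) = mk≈ $ subst (_ ∣_) (regroup x x' y y') (ℤD.∣m∣n⇒∣m+n d e)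
      where regroup : ∀ x x' y y' → (x - x') + (y - y') ≡ (x + y) - (x' + y')
            regroup = solve-∀

    neg-cong : ∀ {x x'} → x ≈ x' → - x ≈ - x'
    neg-cong {x} {x'} (mk≈ d) = mk≈ $ subst (_ ∣_) (regroup x x') (ℤD.∣m⇒∣-m d)
      where regroup : ∀ x x' → - (x - x') ≡ (- x) - (- x')
            regroup = solve-∀

    -cong : ∀ {x x' y y'} → x ≈ x' → y ≈ y' → x - y ≈ x' - y'
    -cong d e = +-cong d (neg-cong e)

    *-cong : ∀ {x x' y y'} → x ≈ x' → y ≈ y' → x * y ≈ x' * y'
    *-cong {x} {x'} {y} {y'} (mk≈ d) (mk≈ e) = mk≈ $
      subst (_ ∣_) (regroup x x' y y') (ℤD.∣m∣n⇒∣m+n (ℤD.∣n⇒∣m*n x e) (ℤD.∣m⇒∣m*n y' d))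
      where regroup : ∀ x x' y y' → x * (y - y') + (x - x') * y' ≡ x * y - x' * y'
            regroup = solve-∀

    *-congˡ : ∀ {x y y'} → y ≈ y' → x * y ≈ x * y'
    *-congˡ {x} = *-cong {x} {x} ≈-refl

    *-congʳ : ∀ {x x' y} → x ≈ x' → x * y ≈ x' * y
    *-congʳ d = *-cong d ≈-refl

    ≈-setoid : Setoid _ _
    ≈-setoid = record { Carrier = ℤ ; _≈_ = _≈_
                      ; isEquivalence = record { refl = ≈-refl ; sym = ≈-sym ; trans = ≈-trans } }

    _≈?_ : ∀ x y → Dec (x ≈ y)
    x ≈? y = map′ mk≈ un≈ ((+ m) ℤD.∣? (x - y))

    ∣⇒≈0 : ∀ {x} → (+ m) ∣ x → x ≈ 0ℤ
    ∣⇒≈0 {x} d = mk≈ (subst (_ ∣_) (sym (x-0≡x x)) d)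
      where x-0≡x : ∀ x → x - 0ℤ ≡ x
            x-0≡x = solve-∀

    ≈0⇒∣ : ∀ {x} → x ≈ 0ℤ → (+ m) ∣ x
    ≈0⇒∣ {x} (mk≈ d) = subst (_ ∣_) (x-0≡x x) d
      where x-0≡x : ∀ x → x - 0ℤ ≡ x
            x-0≡x = solve-∀

    ≈0⇒∣ℕ : ∀ {n} → + n ≈ 0ℤ → m ℕD.∣ n
    ≈0⇒∣ℕ d = ∣⇒∣ᵤ (≈0⇒∣ d)

    sub≈0⇒≈ : ∀ {x y} → x - y ≈ 0ℤ → x ≈ y
    sub≈0⇒≈ {x} {y} e = mk≈ (≈0⇒∣ e)

    ≈⇒sub≈0 : ∀ {x y} → x ≈ y → x - y ≈ 0ℤ
    ≈⇒sub≈0 e = ∣⇒≈0 (un≈ e)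

    cancel-+ : ∀ {X Y} → X + Y ≈ X → Y ≈ 0ℤ
    cancel-+ {X} {Y} e = ∣⇒≈0 (subst (_ ∣_) (difference X Y) (un≈ e))
      where difference : ∀ X Y → (X + Y) - X ≡ Y
            difference = solve-∀

    %-≈ : ∀ x n .{{_ : NonZero n}} → m ℕD.∣ n → + (x % n) ≈ + x
    %-≈ x n m∣n = mk≈ $ subst (+ m ∣_) rearranged
                    (ℤD.∣m⇒∣-m (∣ᵤ⇒∣ (ℕD.∣n⇒∣m*n (x / n) m∣n)))
      where
        division : + (x % n) + + (x / n ℕ.* n) ≡ + x
        division = trans (sym (ℤP.pos-+ (x % n) _)) (cong +_ (sym (ℕDM.m≡m%n+[m/n]*n x n)))
        rearranged : - + (x / n ℕ.* n) ≡ + (x % n) - + x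
        rearranged = trans (sym (r-[r+q]≡-q (+ (x % n)) _)) (cong (λ z → + (x % n) - z) division)
          where r-[r+q]≡-q : ∀ r q → r - (r + q) ≡ - q
                r-[r+q]≡-q = solve-∀

    private
      ordered : ∀ {a b} → a ≤ b → b < m → + a ≈ + b → a ≡ b
      ordered {a} {b} a≤b b<m (mk≈ d) with b ℕ.∸ a in eq
      ... | ℕ.zero  = ℕP.≤-antisym a≤b (ℕP.m∸n≡0⇒m≤n eq)
      ... | ℕ.suc k = contradiction (subst (m ℕD.∣_) eq m∣b∸a)
                        (ℕD.>⇒∤ (subst (_< m) eq (ℕP.≤-<-trans (ℕP.m∸n≤m b a) b<m)))
        where m∣b∸a : m ℕD.∣ b ℕ.∸ a
              m∣b∸a = subst (m ℕD.∣_) (trans (cong ∣_∣ (ℤP.m-n≡m⊖n a b)) (ℤP.∣⊖∣-≤ a≤b)) (∣⇒∣ᵤ d)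

    small-inj : ∀ {a b} → a < m → b < m → + a ≈ + b → a ≡ b
    small-inj {a} {b} a<m b<m a≈b with ℕP.≤-total a b
    ... | inj₁ a≤b = ordered a≤b b<m a≈b
    ... | inj₂ b≤a = sym (ordered b≤a a<m (≈-sym a≈b))

module PrimeFields where
  open import Data.Nat using (ℕ; NonZero)
  open import Data.Nat.Primality using (Prime; euclidsLemma; prime⇒nonZero; prime⇒irreducible)
  open import Data.Nat.Coprimality using (Coprime; coprime-Bézout)
  open import Data.Nat.GCD using (module Bézout)
  import Data.Nat.Divisibility as ℕD
  open import Data.Integer using (ℤ; +_; _+_; _*_; -_; _-_; 0ℤ; 1ℤ; ∣_∣; _%ℕ_; _/ℕ_)
  open import Data.Integer.Properties using (abs-*; pos-+; pos-*)
  open import Data.Integer.DivMod using (a≡a%ℕn+[a/ℕn]*n)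
  open import Data.Integer.Divisibility.Signed using (divides; ∣⇒∣ᵤ; ∣ᵤ⇒∣)
  open import Data.Integer.Tactic.RingSolver using (solve-∀)
  open import Data.Product using (Σ; _,_; proj₁; proj₂)
  open import Data.Sum using (_⊎_; inj₁; inj₂)
  open import Relation.Binary.PropositionalEquality
  open import Relation.Nullary using (¬_; yes; no; contradiction)
  open Congruences

  prime⇒coprime-∤ : ∀ {p n} → Prime p → ¬ (p ℕD.∣ n) → Coprime n p
  prime⇒coprime-∤ pr p∤n (i∣n , i∣p) with prime⇒irreducible pr i∣p
  ... | inj₁ i≡1 = i≡1
  ... | inj₂ refl = contradiction i∣n p∤n

  module PrimeField (p : ℕ) (pr : Prime p) where
    open Congruence p public
    instance
      p≢0 : NonZero p
      p≢0 = prime⇒nonZero pr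

    reduce : ∀ x → x ≈ + (x %ℕ p)
    reduce x = mk≈ (divides (x /ℕ p) (x-r≡q*p x (+ (x %ℕ p)) (x /ℕ p) (+ p) (a≡a%ℕn+[a/ℕn]*n x p)))
      where x-r≡q*p : ∀ x r q P → x ≡ r + q * P → x - r ≡ q * P
            x-r≡q*p x r q P refl = cancel r q P
              where cancel : ∀ r q P → r + q * P - r ≡ q * P
                    cancel = solve-∀

    domain : ∀ {x y} → x * y ≈ 0ℤ → x ≈ 0ℤ ⊎ y ≈ 0ℤ
    domain {x} {y} e with euclidsLemma ∣ x ∣ ∣ y ∣ pr (subst (ℕD._∣_ p) (abs-* x y) (∣⇒∣ᵤ (≈0⇒∣ e)))
    ... | inj₁ d = inj₁ (∣⇒≈0 (∣ᵤ⇒∣ d))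
    ... | inj₂ d = inj₂ (∣⇒≈0 (∣ᵤ⇒∣ d))

    *≉0 : ∀ {x y} → ¬ (x ≈ 0ℤ) → ¬ (y ≈ 0ℤ) → ¬ (x * y ≈ 0ℤ)
    *≉0 nx ny e with domain e
    ... | inj₁ d = nx d
    ... | inj₂ d = ny d

    private
      inverseℕ : ∀ r → Coprime r p → Σ ℤ λ y → + r * y ≈ 1ℤ
      inverseℕ r c with coprime-Bézout c
      ... | Bézout.+- a b eq = + a , mk≈ (divides (+ b) (lemma (+ r) (+ a) (+ b) (+ p) eqℤ))
        where
          eqℤ : 1ℤ + + b * + p ≡ + a * + r
          eqℤ = trans (cong (λ z → 1ℤ + z) (sym (pos-* b p))) (trans (sym (pos-+ 1 _)) (trans (cong +_ eq) (pos-* a r)))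
          lemma : ∀ R A B P → 1ℤ + B * P ≡ A * R → R * A - 1ℤ ≡ B * P
          lemma R A B P e = trans (cong (_- 1ℤ) (trans (comm R A) (sym e))) (cancel B P)
            where comm : ∀ R A → R * A ≡ A * R
                  comm = solve-∀
                  cancel : ∀ B P → 1ℤ + B * P - 1ℤ ≡ B * P
                  cancel = solve-∀
      ... | Bézout.-+ a b eq = - + a , mk≈ (divides (- + b) (lemma (+ r) (+ a) (+ b) (+ p) eqℤ))
        where
          eqℤ : 1ℤ + + a * + r ≡ + b * + p
          eqℤ = trans (cong (λ z → 1ℤ + z) (sym (pos-* a r))) (trans (sym (pos-+ 1 _)) (trans (cong +_ eq) (pos-* b p)))
          lemma : ∀ R A B P → 1ℤ + A * R ≡ B * P → R * (- A) - 1ℤ ≡ (- B) * P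
          lemma R A B P e = trans (negate R A) (trans (cong -_ e) (neg-* B P))
            where negate : ∀ R A → R * (- A) - 1ℤ ≡ - (1ℤ + A * R)
                  negate = solve-∀
                  neg-* : ∀ B P → - (B * P) ≡ (- B) * P
                  neg-* = solve-∀

    inverse : ∀ {x} → ¬ (x ≈ 0ℤ) → Σ ℤ λ y → x * y ≈ 1ℤ
    inverse {x} nz with inverseℕ (x %ℕ p) (prime⇒coprime-∤ pr p∤r)
      where p∤r : ¬ (p ℕD.∣ x %ℕ p)
            p∤r d = nz (≈-trans (reduce x) (∣⇒≈0 (∣ᵤ⇒∣ d)))
    ... | y , ry≈1 = y , ≈-trans (*-congʳ (reduce x)) ry≈1

    -- The inverse as a total function (0 is sent to 0).
    inv : ℤ → ℤ
    inv x with x ≈? 0ℤ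
    ... | yes _ = 0ℤ
    ... | no nz = proj₁ (inverse nz)

    inv-ok : ∀ x → ¬ (x ≈ 0ℤ) → x * inv x ≈ 1ℤ
    inv-ok x nz with x ≈? 0ℤ
    ... | yes z = contradiction z nz
    ... | no nz′ = proj₂ (inverse nz′)

    cancel : ∀ {x y z} → ¬ (z ≈ 0ℤ) → x * z ≈ y * z → x ≈ y
    cancel {x} {y} {z} nz e with domain {x - y} {z} (≈-trans (≡⇒≈ (distrib x y z)) (≈⇒sub≈0 e))
      where distrib : ∀ x y z → (x - y) * z ≡ x * z - y * z
            distrib = solve-∀
    ... | inj₁ d = sub≈0⇒≈ d
    ... | inj₂ d = contradiction d nz

    inv-unique : ∀ {d u} → ¬ (d ≈ 0ℤ) → d * u ≈ 1ℤ → u ≈ inv d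
    inv-unique {d} {u} nz e =
      cancel nz (≈-trans (≡⇒≈ (comm u d)) (≈-trans e (≈-trans (≈-sym (inv-ok d nz)) (≡⇒≈ (comm d (inv d))))))
      where comm : ∀ a b → a * b ≡ b * a
            comm = solve-∀

module DividedDifferences where
  open import Data.Nat as ℕ using (ℕ; zero; suc; s≤s; z≤n)
  import Data.Nat.Properties as ℕP
  open import Data.Nat.Primality using (Prime)
  open import Data.Integer using (ℤ; +_; _+_; _*_; -_; _-_; 0ℤ; 1ℤ; _^_)
  open import Data.Integer.Tactic.RingSolver using (solve-∀)
  open import Data.List using (List; []; _∷_; length)
  open import Data.List.Relation.Unary.All as All using (All; []; _∷_)
  open import Data.List.Relation.Unary.AllPairs using (AllPairs; []; _∷_)
  open import Data.List.Membership.Propositional using (_∈_)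
  open import Data.List.Relation.Unary.Any using (here; there)
  open import Data.Empty using (⊥-elim)
  open import Relation.Binary.PropositionalEquality
  open import Relation.Nullary using (¬_)
  open PrimeFields

  δ : ℕ → ℕ → ℕ
  δ zero zero = 1
  δ zero (suc k) = 0
  δ (suc m) zero = 0
  δ (suc m) (suc k) = δ m k

  δ-≢ : ∀ {m k} → m ≢ k → δ m k ≡ 0
  δ-≢ {zero} {zero} m≢k = ⊥-elim (m≢k refl)
  δ-≢ {zero} {suc k} _ = refl
  δ-≢ {suc m} {zero} _ = refl
  δ-≢ {suc m} {suc k} m≢k = δ-≢ (λ e → m≢k (cong suc e))

  δ-refl : ∀ k → δ k k ≡ 1
  δ-refl zero = refl
  δ-refl (suc k) = δ-refl k

  -- Divided differences over ℤ/p.  For nodes a₀,…,a_k distinct mod p, the top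
  -- divided difference Δ A f = Σ_{a ∈ A} f a · ∏_{b ∈ A, b ≠ a} (a - b)⁻¹ is the
  -- leading coefficient of the interpolation polynomial of f; in particular it
  -- sends the monomial a ↦ a^m (m ≤ k) to δ m k.  This is the linear functional
  -- behind the Combinatorial Nullstellensatz.
  module DividedDifference (p : ℕ) (pr : Prime p) where
    open PrimeField p pr public

    Distinct : List ℤ → Set
    Distinct = AllPairs (λ a b → ¬ (a ≈ b))

    weight : ℤ → List ℤ → ℤ
    weight x [] = 1ℤ
    weight x (b ∷ bs) = inv (x - b) * weight x bs

    -- Peeling off the first node x: the remaining terms are those of Δ xs
    -- applied to a ↦ f a / (a - x).
    Δ : List ℤ → (ℤ → ℤ) → ℤ
    Δ [] f = 0ℤ
    Δ (x ∷ xs) f = f x * weight x xs + Δ xs (λ a → f a * inv (a - x))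

    Δ-cong : ∀ xs {f g} → (∀ a → a ∈ xs → f a ≈ g a) → Δ xs f ≈ Δ xs g
    Δ-cong [] h = ≈-refl
    Δ-cong (x ∷ xs) h =
      +-cong (*-congʳ (h x (here refl))) (Δ-cong xs (λ a a∈ → *-congʳ (h a (there a∈))))

    Δ-+ : ∀ xs f g → Δ xs (λ a → f a + g a) ≈ Δ xs f + Δ xs g
    Δ-+ [] f g = ≈-refl
    Δ-+ (x ∷ xs) f g =
      ≈-trans (+-cong (≈-refl {(f x + g x) * weight x xs})
                (≈-trans (Δ-cong xs (λ a _ → ≡⇒≈ (distribʳ (f a) (g a) (inv (a - x)))))
                         (Δ-+ xs (λ a → f a * inv (a - x)) (λ a → g a * inv (a - x)))))
              (≡⇒≈ (regroup (f x) (g x) (weight x xs) _ _))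
      where
        distribʳ : ∀ A B I → (A + B) * I ≡ A * I + B * I
        distribʳ = solve-∀
        regroup : ∀ A B P X Y → (A + B) * P + (X + Y) ≡ (A * P + X) + (B * P + Y)
        regroup = solve-∀

    Δ-scal : ∀ xs c f → Δ xs (λ a → c * f a) ≈ c * Δ xs f
    Δ-scal [] c f = ≡⇒≈ (zeroʳ c)
      where zeroʳ : ∀ c → 0ℤ ≡ c * 0ℤ
            zeroʳ = solve-∀
    Δ-scal (x ∷ xs) c f =
      ≈-trans (+-cong (≈-refl {(c * f x) * weight x xs})
                (≈-trans (Δ-cong xs (λ a _ → ≡⇒≈ (assoc c (f a) (inv (a - x)))))
                         (Δ-scal xs c (λ a → f a * inv (a - x)))))
              (≡⇒≈ (factor c (f x) (weight x xs) _))
      where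
        assoc : ∀ C A I → (C * A) * I ≡ C * (A * I)
        assoc = solve-∀
        factor : ∀ C A P X → (C * A) * P + C * X ≡ C * (A * P + X)
        factor = solve-∀

    Δ-0 : ∀ xs → Δ xs (λ _ → 0ℤ) ≈ 0ℤ
    Δ-0 xs = ≈-trans (Δ-cong xs (λ a _ → ≈-refl)) (≈-trans (Δ-scal xs 0ℤ (λ _ → 0ℤ)) ≈-refl)

    Δ-sub : ∀ xs f g → Δ xs (λ a → f a - g a) ≈ Δ xs f - Δ xs g
    Δ-sub xs f g =
      ≈-trans (Δ-cong xs (λ a _ → ≡⇒≈ (as-sum (f a) (g a))))
       (≈-trans (Δ-+ xs f (λ a → - 1ℤ * g a))
        (≈-trans (+-cong (≈-refl {Δ xs f}) (Δ-scal xs (- 1ℤ) g)) (≡⇒≈ (sym (as-sum (Δ xs f) (Δ xs g))))))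
      where as-sum : ∀ F G → F - G ≡ F + (- 1ℤ) * G
            as-sum = solve-∀

    ≉⇒sub≉0 : ∀ {x y} → ¬ (x ≈ y) → ¬ (x - y ≈ 0ℤ)
    ≉⇒sub≉0 x≉y e = x≉y (sub≈0⇒≈ e)

    inv-neg : ∀ {x y} → ¬ (x ≈ y) → inv (y - x) ≈ - inv (x - y)
    inv-neg {x} {y} x≉y = ≈-sym (inv-unique (≉⇒sub≉0 (λ e → x≉y (≈-sym e)))
                            (≈-trans (≡⇒≈ (flip x y (inv (x - y)))) (inv-ok (x - y) (≉⇒sub≉0 x≉y))))
      where flip : ∀ x y I → (y - x) * (- I) ≡ (x - y) * I
            flip = solve-∀

    partial-fraction : ∀ {a x y} → ¬ (a ≈ x) → ¬ (a ≈ y) → ¬ (x ≈ y) →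
      inv (a - x) * inv (a - y) ≈ inv (x - y) * (inv (a - x) - inv (a - y))
    partial-fraction {a} {x} {y} a≉x a≉y x≉y = cancel denominator≉0 (≈-trans lhs (≈-sym rhs))
      where
        α = inv (a - x)
        β = inv (a - y)
        γ = inv (x - y)
        denominator≉0 : ¬ (((a - x) * (a - y)) * (x - y) ≈ 0ℤ)
        denominator≉0 = *≉0 (*≉0 (≉⇒sub≉0 a≉x) (≉⇒sub≉0 a≉y)) (≉⇒sub≉0 x≉y)
        lhs : (α * β) * (((a - x) * (a - y)) * (x - y)) ≈ x - y
        lhs = ≈-trans (≡⇒≈ (e₁ a x y α β))
                (≈-trans (*-cong (*-cong (inv-ok (a - x) (≉⇒sub≉0 a≉x)) (inv-ok (a - y) (≉⇒sub≉0 a≉y))) (≈-refl {x - y}))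
                         (≡⇒≈ (e₂ (x - y))))
          where e₁ : ∀ a x y α β → (α * β) * (((a - x) * (a - y)) * (x - y)) ≡ ((a - x) * α) * ((a - y) * β) * (x - y)
                e₁ = solve-∀
                e₂ : ∀ d → 1ℤ * 1ℤ * d ≡ d
                e₂ = solve-∀
        rhs : (γ * (α - β)) * (((a - x) * (a - y)) * (x - y)) ≈ x - y
        rhs = ≈-trans (≡⇒≈ (e₁ a x y α β γ))
                (≈-trans (*-cong (inv-ok (x - y) (≉⇒sub≉0 x≉y))
                                 (-cong (*-congʳ (inv-ok (a - x) (≉⇒sub≉0 a≉x))) (*-congʳ (inv-ok (a - y) (≉⇒sub≉0 a≉y)))))
                         (≡⇒≈ (e₂ a x y)))
          where e₁ : ∀ a x y α β γ → (γ * (α - β)) * (((a - x) * (a - y)) * (x - y))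
                                       ≡ ((x - y) * γ) * (((a - x) * α) * (a - y) - ((a - y) * β) * (a - x))
                e₁ = solve-∀
                e₂ : ∀ a x y → 1ℤ * (1ℤ * (a - y) - 1ℤ * (a - x)) ≡ x - y
                e₂ = solve-∀

    NotIn : ℤ → List ℤ → Set
    NotIn x xs = All (λ b → ¬ (x ≈ b)) xs

    Δ-fraction : ∀ x y ys → Distinct (y ∷ ys) → NotIn x (y ∷ ys) →
      Δ (y ∷ ys) (λ a → inv (a - x)) ≈ - weight x (y ∷ ys)
    Δ-fraction x y [] _ (x≉y ∷ []) =
      ≈-trans (≡⇒≈ (e₁ (inv (y - x)))) (≈-trans (inv-neg x≉y) (≡⇒≈ (e₂ (inv (x - y)))))
      where e₁ : ∀ I → I * 1ℤ + 0ℤ ≡ I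
            e₁ = solve-∀
            e₂ : ∀ I → - I ≡ - (I * 1ℤ)
            e₂ = solve-∀
    Δ-fraction x y (z ∷ zs) (y∉zs ∷ dzs) (x≉y ∷ x∉zs) =
      ≈-trans (+-cong (*-congʳ (inv-neg x≉y)) rest)
              (≡⇒≈ (e (inv (x - y)) (weight y (z ∷ zs)) (weight x (z ∷ zs))))
      where
        e : ∀ G Py Px → (- G) * Py + G * (- Px - - Py) ≡ - (G * Px)
        e = solve-∀
        rest : Δ (z ∷ zs) (λ a → inv (a - x) * inv (a - y)) ≈ inv (x - y) * (- weight x (z ∷ zs) - - weight y (z ∷ zs))
        rest =
          ≈-trans (Δ-cong (z ∷ zs) (λ a a∈ → partial-fraction (λ e → All.lookup x∉zs a∈ (≈-sym e))
                                                                (λ e → All.lookup y∉zs a∈ (≈-sym e)) x≉y))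
          (≈-trans (Δ-scal (z ∷ zs) (inv (x - y)) (λ a → inv (a - x) - inv (a - y)))
          (*-congˡ {inv (x - y)} (≈-trans (Δ-sub (z ∷ zs) (λ a → inv (a - x)) (λ a → inv (a - y)))
             (-cong (Δ-fraction x z zs dzs x∉zs) (Δ-fraction y z zs dzs y∉zs)))))

    geo : ℕ → ℤ → ℤ → ℤ
    geo zero a x = 0ℤ
    geo (suc m) a x = a ^ m + x * geo m a x

    geo-id : ∀ a x m → (a - x) * geo m a x + x ^ m ≡ a ^ m
    geo-id a x zero = e (a - x)
      where e : ∀ d → d * 0ℤ + 1ℤ ≡ 1ℤ
            e = solve-∀
    geo-id a x (suc m) = trans (e₁ a x (a ^ m) (geo m a x) (x ^ m))
                           (trans (cong (λ z → (a - x) * a ^ m + x * z) (geo-id a x m)) (e₂ a x (a ^ m)))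
      where e₁ : ∀ a x A G X → (a - x) * (A + x * G) + x * X ≡ (a - x) * A + x * ((a - x) * G + X)
            e₁ = solve-∀
            e₂ : ∀ a x A → (a - x) * A + x * A ≡ a * A
            e₂ = solve-∀

    geo-split : ∀ {a x} m → ¬ (a ≈ x) → a ^ m * inv (a - x) ≈ geo m a x + x ^ m * inv (a - x)
    geo-split {a} {x} m a≉x =
      ≈-trans (≡⇒≈ (trans (cong (_* inv (a - x)) (sym (geo-id a x m))) (e₁ a x (geo m a x) (x ^ m) (inv (a - x)))))
        (≈-trans (+-cong (*-congʳ (inv-ok (a - x) (≉⇒sub≉0 a≉x))) (≈-refl {x ^ m * inv (a - x)}))
          (≡⇒≈ (e₂ (geo m a x) (x ^ m * inv (a - x)))))
      where e₁ : ∀ a x G X I → ((a - x) * G + X) * I ≡ ((a - x) * I) * G + X * I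
            e₁ = solve-∀
            e₂ : ∀ G Y → 1ℤ * G + Y ≡ G + Y
            e₂ = solve-∀

    -- Proved simultaneously with the same statement for geo m a x, which is a
    -- polynomial in a of degree m - 1 with leading coefficient 1.
    mutual
      Δ-power : ∀ k xs → length xs ≡ suc k → Distinct xs → ∀ m → m ℕ.≤ k → Δ xs (λ a → a ^ m) ≈ + δ m k
      Δ-power zero (x ∷ []) _ _ zero z≤n = ≈-refl
      Δ-power (suc k) (x ∷ y ∷ ys) len (x∉ys ∷ dys) m m≤ =
        ≈-trans (+-cong (≈-refl {x ^ m * weight x (y ∷ ys)}) rest)
                (≡⇒≈ (e (x ^ m) (weight x (y ∷ ys)) (+ δ m (suc k))))
        where
          e : ∀ X P D → X * P + (D + X * (- P)) ≡ D
          e = solve-∀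
          rest : Δ (y ∷ ys) (λ a → a ^ m * inv (a - x)) ≈ + δ m (suc k) + x ^ m * (- weight x (y ∷ ys))
          rest =
            ≈-trans (Δ-cong (y ∷ ys) (λ a a∈ → geo-split m (λ e → All.lookup x∉ys a∈ (≈-sym e))))
            (≈-trans (Δ-+ (y ∷ ys) (λ a → geo m a x) (λ a → x ^ m * inv (a - x)))
            (+-cong (Δ-geo k (y ∷ ys) x (ℕP.suc-injective len) dys m m≤)
                    (≈-trans (Δ-scal (y ∷ ys) (x ^ m) (λ a → inv (a - x)))
                             (*-congˡ {x ^ m} (Δ-fraction x y ys dys x∉ys)))))

      Δ-geo : ∀ k ys x → length ys ≡ suc k → Distinct ys → ∀ m → m ℕ.≤ suc k → Δ ys (λ a → geo m a x) ≈ + δ m (suc k)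
      Δ-geo k ys x len d zero _ = Δ-0 ys
      Δ-geo k ys x len d (suc m) (s≤s m≤) =
        ≈-trans (Δ-+ ys (λ a → a ^ m) (λ a → x * geo m a x))
        (≈-trans (+-cong (Δ-power k ys len d m m≤)
                         (≈-trans (Δ-scal ys x (λ a → geo m a x)) (*-congˡ {x} (Δ-geo k ys x len d m (ℕP.m≤n⇒m≤1+n m≤)))))
        (≡⇒≈ (trans (cong (λ z → + δ m k + x * + z) (δ-≢ (ℕP.<⇒≢ (s≤s m≤)))) (e (+ δ m k) x))))
        where e : ∀ A X → A + X * + 0 ≡ A
              e = solve-∀

    Δ-below : ∀ {k A} → length A ≡ suc k → Distinct A → ∀ {e} → e ℕ.< k → Δ A (λ a → a ^ e) ≈ 0ℤ
    Δ-below {k} {A} len d {e} e<k = ≈-trans (Δ-power k A len d e (ℕP.<⇒≤ e<k)) (≡⇒≈ (cong +_ (δ-≢ (ℕP.<⇒≢ e<k))))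

    Δ-top : ∀ {k A} → length A ≡ suc k → Distinct A → Δ A (λ a → a ^ k) ≈ 1ℤ
    Δ-top {k} {A} len d = ≈-trans (Δ-power k A len d k ℕP.≤-refl) (≡⇒≈ (cong +_ (δ-refl k)))

module TrinomialCoefficients where
  open import Data.Nat using (ℕ; zero; suc; _+_; _*_; _∸_; _≤_; _<_; _≟_; _<?_; _!; s≤s)
  open import Data.Nat.Properties
  open import Data.Nat.Combinatorics.Base using (_P′_)
  open import Data.Nat.Tactic.RingSolver using (solve-∀)
  open import Data.Product using (_×_; _,_)
  open import Data.Sum using (inj₁; inj₂)
  open import Relation.Binary.PropositionalEquality
  open import Relation.Nullary using (yes; no; contradiction)
  open DividedDifferences using (δ; δ-≢; δ-refl)

  P′-vanishes : ∀ {k e} → k < e → k P′ e ≡ 0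
  P′-vanishes {k} {suc e} (s≤s k≤e) with m≤n⇒m<n∨m≡n k≤e
  ... | inj₁ k<e rewrite P′-vanishes k<e = *-zeroʳ (k ∸ e)
  ... | inj₂ refl rewrite n∸n≡0 k = refl

  P′-factorial : ∀ k e → e ≤ k → (k P′ e) * (k ∸ e) ! ≡ k !
  P′-factorial k zero _ = +-identityʳ (k !)
  P′-factorial k (suc e) e<k = begin
    (k ∸ e) * (k P′ e) * (k ∸ suc e) !     ≡⟨ regroup (k ∸ e) (k P′ e) ((k ∸ suc e) !) ⟩
    (k P′ e) * ((k ∸ e) * (k ∸ suc e) !)   ≡⟨ cong (λ n → (k P′ e) * (n * (k ∸ suc e) !)) k∸e≡ ⟩
    (k P′ e) * (suc (k ∸ suc e)) !         ≡⟨ cong (λ n → (k P′ e) * n !) (sym k∸e≡) ⟩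
    (k P′ e) * (k ∸ e) !                   ≡⟨ P′-factorial k e (<⇒≤ e<k) ⟩
    k ! ∎
    where
      open ≡-Reasoning
      k∸e≡ : k ∸ e ≡ suc (k ∸ suc e)
      k∸e≡ = +-∸-assoc 1 e<k
      regroup : ∀ a b c → a * b * c ≡ b * (a * c)
      regroup = solve-∀

  P′-self : ∀ k → k P′ k ≡ k !
  P′-self k = trans (sym (*-identityʳ (k P′ k)))
                    (trans (cong (λ n → (k P′ k) * n !) (sym (n∸n≡0 k))) (P′-factorial k k ≤-refl))

  squeeze : ∀ {e₁ e₂ e₃ k₁ k₂ k₃} → k₁ ≤ e₁ → k₂ ≤ e₂ → k₃ ≤ e₃ → e₁ + e₂ + e₃ ≤ k₁ + k₂ + k₃ →
            e₁ ≡ k₁ × e₂ ≡ k₂ × e₃ ≡ k₃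
  squeeze {e₁} {e₂} {e₃} {k₁} {k₂} {k₃} h₁ h₂ h₃ h =
      ≤-antisym (last≤ h₂ h₃ (rotate {e₁} {e₂} {e₃} {k₁} {k₂} {k₃} h)) h₁
    , ≤-antisym (last≤ h₃ h₁ (rotate {e₂} {e₃} {e₁} {k₂} {k₃} {k₁} (rotate {e₁} {e₂} {e₃} {k₁} {k₂} {k₃} h))) h₂
    , ≤-antisym (last≤ h₁ h₂ h) h₃
    where
      last≤ : ∀ {a b c x y z} → x ≤ a → y ≤ b → a + b + c ≤ x + y + z → c ≤ z
      last≤ {a} {b} x≤a y≤b h = +-cancelˡ-≤ (a + b) _ _ (≤-trans h (+-monoˡ-≤ _ (+-mono-≤ x≤a y≤b)))
      rot : ∀ a b c → a + b + c ≡ b + c + a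
      rot = solve-∀
      rotate : ∀ {a b c x y z} → a + b + c ≤ x + y + z → b + c + a ≤ y + z + x
      rotate {a} {b} {c} {x} {y} {z} = subst₂ _≤_ (rot a b c) (rot x y z)

  -- W e₁ e₂ e₃ N is the coefficient of x^k₁ y^k₂ z^k₃ in x^e₁ y^e₂ z^e₃ (x+y+z)^N,
  -- defined by expanding one factor x+y+z at a time.
  module Trinomial (k₁ k₂ k₃ : ℕ) where
    K : ℕ
    K = k₁ + k₂ + k₃

    W : ℕ → ℕ → ℕ → ℕ → ℕ
    W e₁ e₂ e₃ zero = δ e₁ k₁ * δ e₂ k₂ * δ e₃ k₃
    W e₁ e₂ e₃ (suc N) = W (suc e₁) e₂ e₃ N + W e₁ (suc e₂) e₃ N + W e₁ e₂ (suc e₃) N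

    shift₁ : ∀ e₁ e₂ e₃ N → suc e₁ + e₂ + e₃ + N ≡ e₁ + e₂ + e₃ + suc N
    shift₁ = solve-∀
    shift₂ : ∀ e₁ e₂ e₃ N → e₁ + suc e₂ + e₃ + N ≡ e₁ + e₂ + e₃ + suc N
    shift₂ = solve-∀
    shift₃ : ∀ e₁ e₂ e₃ N → e₁ + e₂ + suc e₃ + N ≡ e₁ + e₂ + e₃ + suc N
    shift₃ = solve-∀

    W-off-degree : ∀ N e₁ e₂ e₃ → e₁ + e₂ + e₃ + N ≢ K → W e₁ e₂ e₃ N ≡ 0
    W-off-degree zero e₁ e₂ e₃ ≢K with e₁ ≟ k₁ | e₂ ≟ k₂ | e₃ ≟ k₃
    ... | yes refl | yes refl | yes refl = contradiction (+-identityʳ _) ≢K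
    ... | no n | _ | _ rewrite δ-≢ n = refl
    ... | yes _ | no n | _ rewrite δ-≢ n = cong (_* δ e₃ k₃) (*-zeroʳ (δ e₁ k₁))
    ... | yes _ | yes _ | no n rewrite δ-≢ n = *-zeroʳ (δ e₁ k₁ * δ e₂ k₂)
    W-off-degree (suc N) e₁ e₂ e₃ ≢K
      rewrite W-off-degree N (suc e₁) e₂ e₃ (λ e → ≢K (trans (sym (shift₁ e₁ e₂ e₃ N)) e))
            | W-off-degree N e₁ (suc e₂) e₃ (λ e → ≢K (trans (sym (shift₂ e₁ e₂ e₃ N)) e))
            | W-off-degree N e₁ e₂ (suc e₃) (λ e → ≢K (trans (sym (shift₃ e₁ e₂ e₃ N)) e)) = refl

    falling : ℕ → ℕ → ℕ → ℕ
    falling e₁ e₂ e₃ = (k₁ P′ e₁) * (k₂ P′ e₂) * (k₃ P′ e₃)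

    K! : ℕ
    K! = k₁ ! * k₂ ! * k₃ !

    private
      remaining : ∀ e₁ e₂ e₃ N → e₁ + e₂ + e₃ + N ≡ K →
        falling e₁ e₂ e₃ * ((k₁ ∸ e₁) + (k₂ ∸ e₂) + (k₃ ∸ e₃)) ≡ falling e₁ e₂ e₃ * N
      remaining e₁ e₂ e₃ N deg with k₁ <? e₁ | k₂ <? e₂ | k₃ <? e₃
      ... | yes lt | _ | _ rewrite P′-vanishes lt = refl
      ... | no _ | yes lt | _ rewrite P′-vanishes lt | *-zeroʳ (k₁ P′ e₁) = refl
      ... | no _ | no _ | yes lt rewrite P′-vanishes lt | *-zeroʳ ((k₁ P′ e₁) * (k₂ P′ e₂)) = refl
      ... | no n₁ | no n₂ | no n₃ = cong (falling e₁ e₂ e₃ *_) (+-cancelˡ-≡ (e₁ + e₂ + e₃) _ _ (begin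
        e₁ + e₂ + e₃ + ((k₁ ∸ e₁) + (k₂ ∸ e₂) + (k₃ ∸ e₃)) ≡⟨ regroup e₁ e₂ e₃ (k₁ ∸ e₁) (k₂ ∸ e₂) (k₃ ∸ e₃) ⟩
        (k₁ ∸ e₁ + e₁) + (k₂ ∸ e₂ + e₂) + (k₃ ∸ e₃ + e₃)      ≡⟨ cong₂ _+_ (cong₂ _+_ (m∸n+n≡m (≮⇒≥ n₁)) (m∸n+n≡m (≮⇒≥ n₂)))
                                                                            (m∸n+n≡m (≮⇒≥ n₃)) ⟩
        K                                                    ≡⟨ sym deg ⟩
        e₁ + e₂ + e₃ + N ∎))
        where
          open ≡-Reasoning
          regroup : ∀ e₁ e₂ e₃ d₁ d₂ d₃ → e₁ + e₂ + e₃ + (d₁ + d₂ + d₃) ≡ (d₁ + e₁) + (d₂ + e₂) + (d₃ + e₃)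
          regroup = solve-∀

    W-closed : ∀ N e₁ e₂ e₃ → e₁ + e₂ + e₃ + N ≡ K → W e₁ e₂ e₃ N * K! ≡ N ! * falling e₁ e₂ e₃
    W-closed zero e₁ e₂ e₃ deg with k₁ <? e₁ | k₂ <? e₂ | k₃ <? e₃
    ... | yes lt | _ | _ rewrite P′-vanishes lt | δ-≢ (>⇒≢ lt) = refl
    ... | no _ | yes lt | _ rewrite P′-vanishes lt | δ-≢ (>⇒≢ lt) | *-zeroʳ (δ e₁ k₁) | *-zeroʳ (k₁ P′ e₁) = refl
    ... | no _ | no _ | yes lt rewrite P′-vanishes lt | δ-≢ (>⇒≢ lt)
                                    | *-zeroʳ (δ e₁ k₁ * δ e₂ k₂) | *-zeroʳ ((k₁ P′ e₁) * (k₂ P′ e₂)) = refl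
    ... | no n₁ | no n₂ | no n₃
      with squeeze {k₁} {k₂} {k₃} {e₁} {e₂} {e₃} (≮⇒≥ n₁) (≮⇒≥ n₂) (≮⇒≥ n₃) (≤-reflexive (trans (sym deg) (+-identityʳ _)))
    ... | refl , refl , refl rewrite δ-refl k₁ | δ-refl k₂ | δ-refl k₃ | P′-self k₁ | P′-self k₂ | P′-self k₃ =
      trans (*-identityˡ K!) (sym (+-identityʳ K!))
    W-closed (suc N) e₁ e₂ e₃ deg = begin
      (W (suc e₁) e₂ e₃ N + W e₁ (suc e₂) e₃ N + W e₁ e₂ (suc e₃) N) * K!
        ≡⟨ distrib (W (suc e₁) e₂ e₃ N) (W e₁ (suc e₂) e₃ N) (W e₁ e₂ (suc e₃) N) K! ⟩
      W (suc e₁) e₂ e₃ N * K! + W e₁ (suc e₂) e₃ N * K! + W e₁ e₂ (suc e₃) N * K!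
        ≡⟨ cong₂ _+_ (cong₂ _+_ (W-closed N (suc e₁) e₂ e₃ (trans (shift₁ e₁ e₂ e₃ N) deg))
                                (W-closed N e₁ (suc e₂) e₃ (trans (shift₂ e₁ e₂ e₃ N) deg)))
                     (W-closed N e₁ e₂ (suc e₃) (trans (shift₃ e₁ e₂ e₃ N) deg)) ⟩
      N ! * falling (suc e₁) e₂ e₃ + N ! * falling e₁ (suc e₂) e₃ + N ! * falling e₁ e₂ (suc e₃)
        ≡⟨ collect (N !) (k₁ P′ e₁) (k₂ P′ e₂) (k₃ P′ e₃) (k₁ ∸ e₁) (k₂ ∸ e₂) (k₃ ∸ e₃) ⟩
      N ! * (falling e₁ e₂ e₃ * ((k₁ ∸ e₁) + (k₂ ∸ e₂) + (k₃ ∸ e₃)))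
        ≡⟨ cong (N ! *_) (remaining e₁ e₂ e₃ (suc N) deg) ⟩
      N ! * (falling e₁ e₂ e₃ * suc N)
        ≡⟨ factorial (N !) (falling e₁ e₂ e₃) N ⟩
      suc N ! * falling e₁ e₂ e₃ ∎
      where
        open ≡-Reasoning
        distrib : ∀ a b c F → (a + b + c) * F ≡ a * F + b * F + c * F
        distrib = solve-∀
        collect : ∀ n f₁ f₂ f₃ d₁ d₂ d₃ → n * (d₁ * f₁ * f₂ * f₃) + n * (f₁ * (d₂ * f₂) * f₃) + n * (f₁ * f₂ * (d₃ * f₃))
                                            ≡ n * (f₁ * f₂ * f₃ * (d₁ + d₂ + d₃))
        collect = solve-∀
        factorial : ∀ n f N → n * (f * suc N) ≡ (suc N * n) * f
        factorial = solve-∀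

module PolynomialMethod where
  open import Data.Nat as ℕ using (ℕ; zero; suc; _≤_; _<_; _∸_; _!)
  import Data.Nat.Properties as ℕP
  import Data.Nat.Divisibility as ℕD
  open import Data.Nat.Primality using (Prime; euclidsLemma; prime⇒nonTrivial)
  open import Data.Integer using (ℤ; +_; _+_; _*_; -_; _-_; 0ℤ; 1ℤ; _^_; _%ℕ_)
  import Data.Integer.Properties as ℤP
  import Data.Integer.DivMod as ℤDM
  open import Data.Integer.Tactic.RingSolver using (solve-∀)
  open import Data.List using (List; []; _∷_; length; applyUpTo)
  open import Data.List.Properties using (length-applyUpTo)
  open import Data.List.Membership.Propositional using (_∈_; find; lose)
  open import Data.List.Membership.Propositional.Properties using (∈-applyUpTo⁺)
  open import Data.List.Relation.Unary.All as All using (All; []; _∷_)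
  open import Data.List.Relation.Unary.Any using (here; there; any?)
  open import Data.Product using (Σ; _×_; _,_)
  open import Data.Sum using (inj₁; inj₂)
  open import Relation.Binary.PropositionalEquality
  import Relation.Binary.Reasoning.Setoid as SetoidReasoning
  open import Relation.Nullary using (¬_; Dec; yes; no; ¬?; _×-dec_; contradiction)
  open DividedDifferences
  open TrinomialCoefficients

  prime∤factorial : ∀ {p} → Prime p → ∀ n → n < p → ¬ (p ℕD.∣ n !)
  prime∤factorial {p} pr zero _ p∣1 = ℕP.<⇒≱ (ℕ.nonTrivial⇒n>1 p {{prime⇒nonTrivial pr}}) (ℕD.∣⇒≤ p∣1)
  prime∤factorial {p} pr (suc n) n<p p∣n! with euclidsLemma (suc n) (n !) pr p∣n!
  ... | inj₁ p∣n = ℕP.<⇒≱ n<p (ℕD.∣⇒≤ p∣n)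
  ... | inj₂ p∣n! = prime∤factorial pr n (ℕP.<-trans (ℕP.n<1+n n) n<p) p∣n!

  monomial : ℕ → ℕ → ℕ → ℤ → ℤ → ℤ → ℤ
  monomial e₁ e₂ e₃ a b c = a ^ e₁ * b ^ e₂ * c ^ e₃

  record Term : Set where
    constructor term
    field
      scalar : ℤ
      e₁ e₂ e₃ : ℕ

  eval : List Term → ℤ → ℤ → ℤ → ℤ
  eval [] a b c = 0ℤ
  eval (term s e₁ e₂ e₃ ∷ ts) a b c = s * monomial e₁ e₂ e₃ a b c + eval ts a b c

  degree : Term → ℕ
  degree (term _ e₁ e₂ e₃) = e₁ ℕ.+ e₂ ℕ.+ e₃

  -- The coefficient of x^k₁ y^k₂ z^k₃ in f · (x+y+z)^N, up to the factor
  -- N!/(k₁! k₂! k₃!) (see coefficient-closed below); the quantity a user of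
  -- the theorem has to show non-zero.
  leading : ℕ → ℕ → ℕ → List Term → ℤ
  leading k₁ k₂ k₃ [] = 0ℤ
  leading k₁ k₂ k₃ (term s e₁ e₂ e₃ ∷ ts) = s * + Trinomial.falling k₁ k₂ k₃ e₁ e₂ e₃ + leading k₁ k₂ k₃ ts

  -- The
  -- functional Λ = Δ_{A₁} ∘ Δ_{A₂} ∘ Δ_{A₃} extracts the coefficient of
  -- a^k₁ b^k₂ c^k₃ from polynomials of total degree ≤ K = k₁+k₂+k₃ and only sees
  -- their values on A₁ × A₂ × A₃.  Applied to f(a,b,c)·∏_{i=1}^{p-1}(a+b+c-t-i),
  -- which vanishes on the grid unless f(a,b,c) ≢ 0 and a+b+c ≡ t, this shows that
  -- such a triple exists whenever the relevant coefficient is non-zero.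
  module RestrictedSumset (p : ℕ) (pr : Prime p) (A₁ A₂ A₃ : List ℤ) (k₁ k₂ k₃ : ℕ)
      (l₁ : length A₁ ≡ suc k₁) (l₂ : length A₂ ≡ suc k₂) (l₃ : length A₃ ≡ suc k₃)
      (d₁ : DividedDifference.Distinct p pr A₁) (d₂ : DividedDifference.Distinct p pr A₂)
      (d₃ : DividedDifference.Distinct p pr A₃) where
    open DividedDifference p pr
    open Trinomial k₁ k₂ k₃

    Λ : (ℤ → ℤ → ℤ → ℤ) → ℤ
    Λ F = Δ A₁ (λ a → Δ A₂ (λ b → Δ A₃ (λ c → F a b c)))

    Λ-cong : ∀ {F G} → (∀ a b c → a ∈ A₁ → b ∈ A₂ → c ∈ A₃ → F a b c ≈ G a b c) → Λ F ≈ Λ G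
    Λ-cong h = Δ-cong A₁ (λ a a∈ → Δ-cong A₂ (λ b b∈ → Δ-cong A₃ (λ c c∈ → h a b c a∈ b∈ c∈)))

    Λ-+ : ∀ F G → Λ (λ a b c → F a b c + G a b c) ≈ Λ F + Λ G
    Λ-+ F G =
      ≈-trans (Δ-cong A₁ (λ a _ → ≈-trans (Δ-cong A₂ (λ b _ → Δ-+ A₃ (F a b) (G a b)))
                                           (Δ-+ A₂ (λ b → Δ A₃ (F a b)) (λ b → Δ A₃ (G a b)))))
              (Δ-+ A₁ _ _)

    Λ-scal : ∀ C F → Λ (λ a b c → C * F a b c) ≈ C * Λ F
    Λ-scal C F =
      ≈-trans (Δ-cong A₁ (λ a _ → ≈-trans (Δ-cong A₂ (λ b _ → Δ-scal A₃ C (F a b)))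
                                           (Δ-scal A₂ C (λ b → Δ A₃ (F a b)))))
              (Δ-scal A₁ C _)

    Λ-0 : Λ (λ _ _ _ → 0ℤ) ≈ 0ℤ
    Λ-0 = ≈-trans (Δ-cong A₁ (λ a _ → ≈-trans (Δ-cong A₂ (λ b _ → Δ-0 A₃)) (Δ-0 A₂))) (Δ-0 A₁)

    Λ-prod : ∀ f g h → Λ (λ a b c → f a * g b * h c) ≈ Δ A₁ f * Δ A₂ g * Δ A₃ h
    Λ-prod f g h =
      ≈-trans (Δ-cong A₁ (λ a _ →
        ≈-trans (Δ-cong A₂ (λ b _ → Δ-scal A₃ (f a * g b) h))
        (≈-trans (Δ-cong A₂ (λ b _ → ≡⇒≈ (e₁ (f a) (g b) (Δ A₃ h))))
                 (Δ-scal A₂ (f a * Δ A₃ h) g))))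
      (≈-trans (Δ-cong A₁ (λ a _ → ≡⇒≈ (e₂ (f a) (Δ A₂ g) (Δ A₃ h))))
      (≈-trans (Δ-scal A₁ (Δ A₂ g * Δ A₃ h) f) (≡⇒≈ (e₃ (Δ A₁ f) (Δ A₂ g) (Δ A₃ h)))))
      where e₁ : ∀ X Y Z → X * Y * Z ≡ (X * Z) * Y
            e₁ = solve-∀
            e₂ : ∀ X Y Z → (X * Z) * Y ≡ (Y * Z) * X
            e₂ = solve-∀
            e₃ : ∀ X Y Z → (Y * Z) * X ≡ X * Y * Z
            e₃ = solve-∀

    Λ-monomial : ∀ e₁ e₂ e₃ → e₁ ℕ.+ e₂ ℕ.+ e₃ ≤ K → Λ (monomial e₁ e₂ e₃) ≈ + W e₁ e₂ e₃ 0
    Λ-monomial e₁ e₂ e₃ deg = ≈-trans (Λ-prod _ _ _) (≈-trans factors (≡⇒≈ (sym δ-product)))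
      where
        δ-product : + W e₁ e₂ e₃ 0 ≡ + δ e₁ k₁ * + δ e₂ k₂ * + δ e₃ k₃
        δ-product = trans (ℤP.pos-* (δ e₁ k₁ ℕ.* δ e₂ k₂) _) (cong (_* + δ e₃ k₃) (ℤP.pos-* (δ e₁ k₁) _))
        zero₁ : ∀ {x y z} → x ≈ 0ℤ → x * y * z ≈ 0ℤ
        zero₁ {x} {y} {z} x≈0 = ≈-trans (*-congʳ (*-congʳ x≈0)) (≡⇒≈ (e y z))
          where e : ∀ y z → 0ℤ * y * z ≡ 0ℤ
                e = solve-∀
        zero₂ : ∀ {x y z} → y ≈ 0ℤ → x * y * z ≈ 0ℤ
        zero₂ {x} {y} {z} y≈0 = ≈-trans (*-congʳ (*-congˡ {x} y≈0)) (≡⇒≈ (e x z))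
          where e : ∀ x z → x * 0ℤ * z ≡ 0ℤ
                e = solve-∀
        zero₃ : ∀ {x y z} → z ≈ 0ℤ → x * y * z ≈ 0ℤ
        zero₃ {x} {y} {z} z≈0 = ≈-trans (*-congˡ {x * y} z≈0) (≡⇒≈ (e x y))
          where e : ∀ x y → x * y * 0ℤ ≡ 0ℤ
                e = solve-∀
        δ≈0 : ∀ {e k} → e < k → + δ e k ≈ 0ℤ
        δ≈0 e<k = ≡⇒≈ (cong +_ (δ-≢ (ℕP.<⇒≢ e<k)))
        X₁ X₂ X₃ Y₁ Y₂ Y₃ : ℤ
        X₁ = Δ A₁ (_^ e₁)
        X₂ = Δ A₂ (_^ e₂)
        X₃ = Δ A₃ (_^ e₃)
        Y₁ = + δ e₁ k₁
        Y₂ = + δ e₂ k₂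
        Y₃ = + δ e₃ k₃
        factors : X₁ * X₂ * X₃ ≈ Y₁ * Y₂ * Y₃
        factors with e₁ ℕ.<? k₁ | e₂ ℕ.<? k₂ | e₃ ℕ.<? k₃
        ... | yes lt | _ | _ = ≈-trans (zero₁ {z = X₃} (Δ-below l₁ d₁ lt)) (≈-sym (zero₁ {y = Y₂} {Y₃} (δ≈0 lt)))
        ... | no _ | yes lt | _ = ≈-trans (zero₂ {X₁} {z = X₃} (Δ-below l₂ d₂ lt)) (≈-sym (zero₂ {Y₁} {z = Y₃} (δ≈0 lt)))
        ... | no _ | no _ | yes lt = ≈-trans (zero₃ {X₁} {X₂} (Δ-below l₃ d₃ lt)) (≈-sym (zero₃ {Y₁} {Y₂} (δ≈0 lt)))
        ... | no n₁ | no n₂ | no n₃ with squeeze (ℕP.≮⇒≥ n₁) (ℕP.≮⇒≥ n₂) (ℕP.≮⇒≥ n₃) deg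
        ...   | refl , refl , refl rewrite δ-refl k₁ | δ-refl k₂ | δ-refl k₃ =
          *-cong (*-cong (Δ-top l₁ d₁) (Δ-top l₂ d₂)) (Δ-top l₃ d₃)

    shifted : List ℤ → ℤ → ℤ
    shifted [] s = 1ℤ
    shifted (c ∷ E) s = (s - c) * shifted E s

    -- Λ (monomial · ∏_{c∈E}(a+b+c-c₀)) is the coefficient W, as long as the
    -- degree does not exceed K: expanding one factor raises one exponent, and the
    -- constant part -c₀ lowers the degree below K, where W vanishes.
    Λ-shifted : ∀ E e₁ e₂ e₃ → e₁ ℕ.+ e₂ ℕ.+ e₃ ℕ.+ length E ≤ K →
      Λ (λ a b c → monomial e₁ e₂ e₃ a b c * shifted E (a + b + c)) ≈ + W e₁ e₂ e₃ (length E)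
    Λ-shifted [] e₁ e₂ e₃ deg =
      ≈-trans (Λ-cong (λ a b c _ _ _ → ≡⇒≈ (ℤP.*-identityʳ (monomial e₁ e₂ e₃ a b c))))
              (Λ-monomial e₁ e₂ e₃ (subst (_≤ K) (ℕP.+-identityʳ _) deg))
    Λ-shifted (c₀ ∷ E) e₁ e₂ e₃ deg = begin
      Λ (λ a b c → monomial e₁ e₂ e₃ a b c * shifted (c₀ ∷ E) (a + b + c))
        ≈⟨ Λ-cong (λ a b c _ _ _ → ≡⇒≈ (expand a b c (a ^ e₁) (b ^ e₂) (c ^ e₃) (Q a b c) c₀)) ⟩
      Λ (λ a b c → ((M₁ a b c + M₂ a b c) + M₃ a b c) + (- c₀) * M a b c)
        ≈⟨ ≈-trans (Λ-+ _ _) (+-cong (≈-trans (Λ-+ _ _) (+-cong (Λ-+ M₁ M₂) ≈-refl)) (Λ-scal (- c₀) M)) ⟩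
      ((Λ M₁ + Λ M₂) + Λ M₃) + (- c₀) * Λ M
        ≈⟨ +-cong (+-cong (+-cong (Λ-shifted E (suc e₁) e₂ e₃ (subst (_≤ K) (sym (shift₁ e₁ e₂ e₃ _)) deg))
                                  (Λ-shifted E e₁ (suc e₂) e₃ (subst (_≤ K) (sym (shift₂ e₁ e₂ e₃ _)) deg)))
                          (Λ-shifted E e₁ e₂ (suc e₃) (subst (_≤ K) (sym (shift₃ e₁ e₂ e₃ _)) deg)))
                  (*-congˡ { - c₀} (Λ-shifted E e₁ e₂ e₃ (ℕP.<⇒≤ below))) ⟩
      ((+ W₁ + + W₂) + + W₃) + (- c₀) * + W e₁ e₂ e₃ (length E)
        ≡⟨ cong (λ w → ((+ W₁ + + W₂) + + W₃) + (- c₀) * + w) (W-off-degree (length E) e₁ e₂ e₃ (ℕP.<⇒≢ below)) ⟩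
      ((+ W₁ + + W₂) + + W₃) + (- c₀) * 0ℤ
        ≡⟨ drop (+ W₁ + + W₂) (+ W₃) c₀ ⟩
      (+ W₁ + + W₂) + + W₃
        ≡⟨ sym (trans (ℤP.pos-+ (W₁ ℕ.+ W₂) W₃) (cong (_+ + W₃) (ℤP.pos-+ W₁ W₂))) ⟩
      + (W₁ ℕ.+ W₂ ℕ.+ W₃) ∎
      where
        open SetoidReasoning ≈-setoid
        Q M M₁ M₂ M₃ : ℤ → ℤ → ℤ → ℤ
        Q a b c = shifted E (a + b + c)
        M a b c = monomial e₁ e₂ e₃ a b c * Q a b c
        M₁ a b c = monomial (suc e₁) e₂ e₃ a b c * Q a b c
        M₂ a b c = monomial e₁ (suc e₂) e₃ a b c * Q a b c
        M₃ a b c = monomial e₁ e₂ (suc e₃) a b c * Q a b c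
        W₁ W₂ W₃ : ℕ
        W₁ = W (suc e₁) e₂ e₃ (length E)
        W₂ = W e₁ (suc e₂) e₃ (length E)
        W₃ = W e₁ e₂ (suc e₃) (length E)
        below : e₁ ℕ.+ e₂ ℕ.+ e₃ ℕ.+ length E < K
        below = subst (_≤ K) (ℕP.+-suc _ (length E)) deg
        expand : ∀ a b c A B C Q c₀ → A * B * C * ((a + b + c - c₀) * Q)
               ≡ (((a * A) * B * C * Q + A * (b * B) * C * Q) + A * B * (c * C) * Q) + (- c₀) * (A * B * C * Q)
        expand = solve-∀
        drop : ∀ X Y c → (X + Y) + (- c) * 0ℤ ≡ X + Y
        drop = solve-∀

    coefficient : ℕ → List Term → ℤ
    coefficient N [] = 0ℤ
    coefficient N (term s e₁ e₂ e₃ ∷ ts) = s * + W e₁ e₂ e₃ N + coefficient N ts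

    Λ-polynomial : ∀ E ts → All (λ t → degree t ℕ.+ length E ≤ K) ts →
      Λ (λ a b c → eval ts a b c * shifted E (a + b + c)) ≈ coefficient (length E) ts
    Λ-polynomial E [] _ = ≈-trans (Λ-cong (λ a b c _ _ _ → ≡⇒≈ (ℤP.*-zeroˡ (shifted E (a + b + c))))) Λ-0
    Λ-polynomial E (term s e₁ e₂ e₃ ∷ ts) (deg ∷ degs) =
      ≈-trans (Λ-cong (λ a b c _ _ _ → ≡⇒≈ (distrib s (monomial e₁ e₂ e₃ a b c) (eval ts a b c) (shifted E (a + b + c)))))
      (≈-trans (Λ-+ (λ a b c → s * (monomial e₁ e₂ e₃ a b c * shifted E (a + b + c)))
                    (λ a b c → eval ts a b c * shifted E (a + b + c)))
      (+-cong (≈-trans (Λ-scal s _) (*-congˡ {s} (Λ-shifted E e₁ e₂ e₃ deg)))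
              (Λ-polynomial E ts degs)))
      where distrib : ∀ s M R Q → (s * M + R) * Q ≡ s * (M * Q) + R * Q
            distrib = solve-∀

    coefficient-closed : ∀ N ts → All (λ t → degree t ℕ.+ N ≡ K) ts →
      coefficient N ts * + K! ≡ + (N !) * leading k₁ k₂ k₃ ts
    coefficient-closed N [] _ = trans (ℤP.*-zeroˡ (+ K!)) (sym (ℤP.*-zeroʳ (+ (N !))))
    coefficient-closed N (term s e₁ e₂ e₃ ∷ ts) (deg ∷ degs) =
      trans (distrib s (+ W e₁ e₂ e₃ N) (coefficient N ts) (+ K!))
      (trans (cong₂ (λ u v → s * u + v)
               (trans (sym (ℤP.pos-* (W e₁ e₂ e₃ N) K!))
                      (trans (cong +_ (W-closed N e₁ e₂ e₃ deg)) (ℤP.pos-* (N !) (falling e₁ e₂ e₃))))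
               (coefficient-closed N ts degs))
      (factor s (+ (N !)) (+ falling e₁ e₂ e₃) (leading k₁ k₂ k₃ ts)))
      where distrib : ∀ s W X F → (s * W + X) * F ≡ s * (W * F) + X * F
            distrib = solve-∀
            factor : ∀ s n f Z → s * (n * f) + n * Z ≡ n * (s * f + Z)
            factor = solve-∀

    others : ℤ → List ℤ
    others t = applyUpTo (λ i → t + + suc i) (p ∸ 1)

    others-hit : ∀ s t → ¬ (s ≈ t) → Σ ℤ λ c₀ → c₀ ∈ others t × s - c₀ ≈ 0ℤ
    others-hit s t s≉t with (s - t) %ℕ p in r≡
    ... | zero = contradiction (sub≈0⇒≈ (≈-trans (reduce (s - t)) (≡⇒≈ (cong +_ r≡)))) s≉t
    ... | suc i = t + + suc i , ∈-applyUpTo⁺ (λ i → t + + suc i) i<p-1 ,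
                   ≈-trans (≡⇒≈ (e₁ s t (+ suc i)))
                     (≈-trans (-cong (≈-trans (reduce (s - t)) (≡⇒≈ (cong +_ r≡))) (≈-refl {+ suc i}))
                              (≡⇒≈ (e₂ (+ suc i))))
      where
        i<p-1 : i < p ∸ 1
        i<p-1 = ℕP.∸-monoˡ-≤ 1 (subst (_< p) r≡ (ℤDM.n%ℕd<d (s - t) p))
        e₁ : ∀ s t i → s - (t + i) ≡ (s - t) - i
        e₁ = solve-∀
        e₂ : ∀ i → i - i ≡ 0ℤ
        e₂ = solve-∀

    shifted-vanishes : ∀ E s c₀ → c₀ ∈ E → s - c₀ ≈ 0ℤ → shifted E s ≈ 0ℤ
    shifted-vanishes (c ∷ E) s .c (here refl) z = ≈-trans (*-congʳ z) (≡⇒≈ (ℤP.*-zeroˡ (shifted E s)))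
    shifted-vanishes (c ∷ E) s c₀ (there c₀∈) z =
      ≈-trans (*-congˡ {s - c} (shifted-vanishes E s c₀ c₀∈ z)) (≡⇒≈ (ℤP.*-zeroʳ (s - c)))

    p-1!≉0 : ¬ (+ ((p ∸ 1) !) ≈ 0ℤ)
    p-1!≉0 z = prime∤factorial pr (p ∸ 1) (pred< p) (≈0⇒∣ℕ z)
      where pred< : ∀ n → .{{ℕ.NonZero n}} → n ∸ 1 < n
            pred< (suc n) = ℕP.n<1+n n

    Good : List Term → ℤ → ℤ → ℤ → ℤ → Set
    Good ts t a b c = ¬ (eval ts a b c ≈ 0ℤ) × (a + b + c ≈ t)

    restricted-sumset : ∀ t ts → All (λ u → degree u ℕ.+ (p ∸ 1) ≡ K) ts → ¬ (leading k₁ k₂ k₃ ts ≈ 0ℤ) →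
      Σ ℤ λ a → a ∈ A₁ × Σ ℤ λ b → b ∈ A₂ × Σ ℤ λ c → c ∈ A₃ × Good ts t a b c
    restricted-sumset t ts hom leading≉0
      with any? (λ a → any? (λ b → any? (λ c → good? a b c) A₃) A₂) A₁
      where good? : ∀ a b c → Dec (Good ts t a b c)
            good? a b c = ¬? (eval ts a b c ≈? 0ℤ) ×-dec ((a + b + c) ≈? t)
    ... | yes found = let (a , a∈ , inA₂) = find found
                          (b , b∈ , inA₃) = find inA₂
                          (c , c∈ , good) = find inA₃
                      in a , a∈ , b , b∈ , c , c∈ , good
    ... | no none = contradiction (≈-sym product≈0) (*≉0 p-1!≉0 leading≉0)
      where
        E = others t
        hom′ : All (λ u → degree u ℕ.+ length E ≡ K) ts
        hom′ = subst (λ N → All (λ u → degree u ℕ.+ N ≡ K) ts) (sym (length-applyUpTo _ (p ∸ 1))) hom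
        vanishes : ∀ a b c → a ∈ A₁ → b ∈ A₂ → c ∈ A₃ → eval ts a b c * shifted E (a + b + c) ≈ 0ℤ
        vanishes a b c a∈ b∈ c∈ with eval ts a b c ≈? 0ℤ
        ... | yes f≈0 = ≈-trans (*-congʳ f≈0) (≡⇒≈ (ℤP.*-zeroˡ (shifted E (a + b + c))))
        ... | no f≉0 =
          let (c₀ , c₀∈ , z) = others-hit (a + b + c) t (λ s≈t → none (lose a∈ (lose b∈ (lose c∈ (f≉0 , s≈t)))))
          in ≈-trans (*-congˡ {eval ts a b c} (shifted-vanishes E _ c₀ c₀∈ z)) (≡⇒≈ (ℤP.*-zeroʳ (eval ts a b c)))
        coefficient≈0 : coefficient (length E) ts ≈ 0ℤ
        coefficient≈0 = ≈-trans (≈-sym (Λ-polynomial E ts (All.map ℕP.≤-reflexive hom′))) (≈-trans (Λ-cong vanishes) Λ-0)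
        product≈0 : 0ℤ ≈ + ((p ∸ 1) !) * leading k₁ k₂ k₃ ts
        product≈0 = ≈-trans (≈-sym (≈-trans (*-congʳ coefficient≈0) (≡⇒≈ (ℤP.*-zeroˡ (+ K!)))))
                      (≡⇒≈ (trans (coefficient-closed (length E) ts hom′)
                                  (cong (λ N → + (N !) * leading k₁ k₂ k₃ ts) (length-applyUpTo _ (p ∸ 1)))))

module GroupCoordinates where
  open import Data.Nat as ℕ using (ℕ; zero; suc; _≤_; _<_; NonZero; _%_; s≤s)
  import Data.Nat.Properties as ℕP
  import Data.Nat.DivMod as ℕDM
  open import Data.Nat.Divisibility as ℕD using (divides; _∣_)
  open import Data.Nat.Primality using (Prime; prime?; prime⇒nonZero; prime⇒irreducible)
  open import Data.Nat.Coprimality using (Coprime; coprime-divisor)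
  open import Data.Integer using (ℤ; +_; _+_; _*_; 0ℤ)
  import Data.Integer.Properties as ℤP
  open import Data.Integer.Divisibility.Signed using (∣⇒∣ᵤ; ∣ᵤ⇒∣)
  open import Data.Integer.Tactic.RingSolver using (solve-∀)
  open import Data.List using (List; []; _∷_; length)
  open import Data.List.Relation.Unary.Any using (here; there)
  open import Data.List.Membership.Propositional using (_∈_; _─_)
  open import Data.List.Properties using (length-removeAt′)
  open import Data.List.Relation.Binary.Sublist.Propositional using (_⊆_; _∷ʳ_; _∷_; ⊆-refl; ⊆-trans)
  open import Data.Product using (_×_; _,_; Σ)
  open import Data.Sum using (inj₁; inj₂)
  open import Relation.Binary.PropositionalEquality
  open import Relation.Nullary using (¬_; contradiction)
  open import Relation.Nullary.Decidable using (toWitness)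
  open import Defs
  open Congruences
  open PrimeFields

  prime3 : Prime 3
  prime3 = toWitness {a? = prime? 3} _

  module ThreeAndP (p : ℕ) (pr : Prime p) (p≥5 : 5 ≤ p) where
    3∤p : ¬ (3 ∣ p)
    3∤p 3∣p with prime⇒irreducible pr 3∣p
    ... | inj₁ ()
    ... | inj₂ refl = ¬5≤3 p≥5
      where ¬5≤3 : ¬ (5 ≤ 3)
            ¬5≤3 (s≤s (s≤s (s≤s ())))

    3⊥p : Coprime 3 p
    3⊥p (i∣3 , i∣p) with prime⇒irreducible prime3 i∣3
    ... | inj₁ i≡1 = i≡1
    ... | inj₂ refl = contradiction i∣p 3∤p

    3p∣ : ∀ {n} → 3 ∣ n → p ∣ n → (3 ℕ.* p) ∣ n
    3p∣ {n} 3∣n (divides q refl) with coprime-divisor 3⊥p (subst (3 ∣_) (ℕP.*-comm q p) 3∣n)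
    ... | divides r refl = divides r (ℕP.*-assoc r 3 p)

  module _ {A : Set} where
    ─-⊆ : ∀ {x : A} {xs} (x∈ : x ∈ xs) → xs ─ x∈ ⊆ xs
    ─-⊆ {xs = y ∷ xs} (here _) = y ∷ʳ ⊆-refl
    ─-⊆ {xs = y ∷ _} (there x∈) = refl ∷ ─-⊆ x∈

    ∈-─ : ∀ {x y : A} {xs} → y ∈ xs → y ≢ x → (x∈ : x ∈ xs) → y ∈ xs ─ x∈
    ∈-─ (here refl) y≢x (here refl) = contradiction refl y≢x
    ∈-─ (here y≡) _ (there x∈) = here y≡
    ∈-─ (there y∈) _ (here _) = y∈
    ∈-─ (there y∈) y≢x (there x∈) = there (∈-─ y∈ y≢x x∈)

  data Axis : Set where
    first second : Axis

  coord : Axis → G → ℤ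
  coord first (a , b) = + a
  coord second (a , b) = + b

  coordSum : Axis → List G → ℤ
  coordSum i [] = 0ℤ
  coordSum i (g ∷ L) = coord i g + coordSum i L

  coordSum-─ : ∀ i {x : G} {xs} (x∈ : x ∈ xs) → coordSum i xs ≡ coord i x + coordSum i (xs ─ x∈)
  coordSum-─ i (here refl) = refl
  coordSum-─ i {x} {y ∷ _} (there x∈) =
    trans (cong (λ z → coord i y + z) (coordSum-─ i x∈)) (swap (coord i y) (coord i x) _)
    where swap : ∀ a b c → a + (b + c) ≡ b + (a + c)
          swap = solve-∀

  module Coordinates (p : ℕ) (pr : Prime p) (p≥5 : 5 ≤ p) where
    open Grp p
    open ThreeAndP p pr p≥5 public
    module M₃ = PrimeField 3 prime3
    module Mₚ = PrimeField p pr

    instance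
      3p≢0 : NonZero (3 ℕ.* p)
      3p≢0 = ℕP.m*n≢0 3 p {{_}} {{prime⇒nonZero pr}}

    modulus : Axis → ℕ
    modulus first = 3
    modulus second = 3 ℕ.* p

    ⊕-coord : ∀ {m} i → m ∣ modulus i → ∀ g h → Congruence._≈_ m (coord i (g ⊕ h)) (coord i g + coord i h)
    ⊕-coord {m} first m∣3 (a , b) (c , d) =
      Congruence.≈-trans m (%-≈ (a ℕ.+ c) 3 m∣3) (Congruence.≡⇒≈ m (ℤP.pos-+ a c))
      where open Congruence m using (%-≈)
    ⊕-coord {m} second m∣3p (a , b) (c , d) =
      Congruence.≈-trans m (Congruence.≡⇒≈ m (cong +_ (red-%  (3 ℕ.* p) (b ℕ.+ d))))
        (Congruence.≈-trans m (Congruence.%-≈ m (b ℕ.+ d) (3 ℕ.* p) m∣3p) (Congruence.≡⇒≈ m (ℤP.pos-+ b d)))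
      where red-% : ∀ n x .{{_ : NonZero n}} → red n x ≡ x % n
            red-% (suc n) x = refl

    3∣modulus : ∀ i → 3 ∣ modulus i
    3∣modulus first = ℕD.∣-refl
    3∣modulus second = divides p (ℕP.*-comm 3 p)

    p∣3p : p ∣ 3 ℕ.* p
    p∣3p = divides 3 refl

    coord-0 : ∀ i → coord i 0G ≡ 0ℤ
    coord-0 first = refl
    coord-0 second = refl

    module Additive {m : ℕ} (i : Axis) (m∣ : m ∣ modulus i) where
      open Congruence m

      σ-coord : ∀ L → coord i (σ L) ≈ coordSum i L
      σ-coord [] = ≡⇒≈ (coord-0 i)
      σ-coord (g ∷ L) = ≈-trans (⊕-coord i m∣ g (σ L)) (+-cong (≈-refl {coord i g}) (σ-coord L))

      ·-coord : ∀ n g → coord i (n · g) ≈ + n * coord i g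
      ·-coord zero g = ≡⇒≈ (trans (coord-0 i) (sym (ℤP.*-zeroˡ (coord i g))))
      ·-coord (suc n) g =
        ≈-trans (⊕-coord i m∣ g (n · g))
          (≈-trans (+-cong (≈-refl {coord i g}) (·-coord n g))
                   (≡⇒≈ (trans (e (coord i g) (+ n)) (cong (_* coord i g) (sym (ℤP.pos-+ 1 n))))))
        where e : ∀ c n → c + n * c ≡ (+ 1 + n) * c
              e = solve-∀

    -- Elements of H₂ have both coordinates ≡ 0 modulo 3, since p is invertible mod 3.
    H₂-coord : ∀ i k → InH2 k → coord i k M₃.≈ 0ℤ
    H₂-coord i k pk≡0 with M₃.domain (M₃.≈-trans (M₃.≈-sym (Additive.·-coord i (3∣modulus i) p k))
                                                 (M₃.≡⇒≈ (trans (cong (coord i) pk≡0) (coord-0 i))))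
    ... | inj₁ p≈0 = contradiction (M₃.≈0⇒∣ℕ p≈0) 3∤p
    ... | inj₂ c≈0 = c≈0

    ⊕-valid : ∀ g h → Valid p (g ⊕ h)
    ⊕-valid (a , b) (c , d) = ℕDM.m%n<n (a ℕ.+ c) 3 , red<3p (b ℕ.+ d)
      where red<3p : ∀ x → red (3 ℕ.* p) x < 3 ℕ.* p
            red<3p x with 3 ℕ.* p | 3p≢0
            ... | suc n | _ = ℕDM.m%n<n x (suc n)

    σ-valid : ∀ L → Valid p (σ L)
    σ-valid [] = s≤s ℕ.z≤n , ℕ.>-nonZero⁻¹ (3 ℕ.* p)
    σ-valid (g ∷ L) = ⊕-valid g (σ L)

    valid-unique : ∀ {u v} → Valid p u → Valid p v → (∀ i → coord i u M₃.≈ coord i v) →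
                   coord second u Mₚ.≈ coord second v → u ≡ v
    valid-unique {a , b} {c , d} (a<3 , b<3p) (c<3 , d<3p) ≈₃ (Mₚ.mk≈ p∣) =
      cong₂ _,_ (M₃.small-inj a<3 c<3 (≈₃ first))
                (Congruence.small-inj (3 ℕ.* p) b<3p d<3p
                  (Congruence.mk≈ (∣ᵤ⇒∣ (3p∣ (∣⇒∣ᵤ (M₃.un≈ (≈₃ second))) (∣⇒∣ᵤ p∣)))))


    module Projection (π : G → G) (hπ : IsProj1 π) where
      π-coord : ∀ i g → Valid p g → coord i (π g) M₃.≈ coord i g
      π-coord i g vg with hπ g vg
      ... | _ , _ , k , _ , k∈H₂ , πg⊕k≡g =
        M₃.≈-sym (M₃.≈-trans (M₃.≡⇒≈ (cong (coord i) (sym πg⊕k≡g)))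
                 (M₃.≈-trans (⊕-coord i (3∣modulus i) (π g) k)
                 (M₃.≈-trans (M₃.+-cong (M₃.≈-refl {coord i (π g)}) (H₂-coord i k k∈H₂))
                             (M₃.≡⇒≈ (ℤP.+-identityʳ (coord i (π g)))))))

    complement-zero-sum : ∀ S {u v w} → u ∈ S → v ∈ S → w ∈ S → u ≢ v → u ≢ w → v ≢ w →
      length S ≡ 3 ℕ.* p ℕ.+ 3 →
      (∀ i → coord i u + coord i v + coord i w M₃.≈ coord i (σ S)) →
      coord second u + coord second v + coord second w Mₚ.≈ coord second (σ S) →
      Σ (List G) λ T → T ⊆ S × length T ≡ 3 ℕ.* p × σ T ≡ 0G
    complement-zero-sum S {u} {v} {w} u∈ v∈ w∈ u≢v u≢w v≢w len ≈₃ ≈ₚ =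
      T , ⊆-trans (─-⊆ w∈₂) (⊆-trans (─-⊆ v∈₁) (─-⊆ u∈)) , length-T ,
      valid-unique (σ-valid T) (s≤s ℕ.z≤n , ℕ.>-nonZero⁻¹ (3 ℕ.* p))
                   (λ i → M₃.≈-trans (rest≈0 i (3∣modulus i) (≈₃ i)) (M₃.≡⇒≈ (sym (coord-0 i))))
                   (rest≈0 second p∣3p ≈ₚ)
      where
        v∈₁ : v ∈ S ─ u∈
        v∈₁ = ∈-─ v∈ (≢-sym u≢v) u∈
        w∈₂ : w ∈ (S ─ u∈) ─ v∈₁
        w∈₂ = ∈-─ (∈-─ w∈ (≢-sym u≢w) u∈) (≢-sym v≢w) v∈₁
        T : List G
        T = ((S ─ u∈) ─ v∈₁) ─ w∈₂
        length-T : length T ≡ 3 ℕ.* p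
        length-T = ℕP.suc-injective (ℕP.suc-injective (ℕP.suc-injective (begin
          3 ℕ.+ length T                                 ≡⟨ sym (trans (length-removeAt′ S _)
                                                              (cong suc (trans (length-removeAt′ (S ─ u∈) _)
                                                                (cong suc (length-removeAt′ ((S ─ u∈) ─ v∈₁) _))))) ⟩
          length S                                       ≡⟨ len ⟩
          3 ℕ.* p ℕ.+ 3                                  ≡⟨ ℕP.+-comm (3 ℕ.* p) 3 ⟩
          3 ℕ.+ 3 ℕ.* p                                  ∎)))
          where open ≡-Reasoning
        split : ∀ i → coordSum i S ≡ (coord i u + coord i v + coord i w) + coordSum i T
        split i = trans (coordSum-─ i u∈) (trans (cong (λ z → coord i u + z) (trans (coordSum-─ i v∈₁)
                    (cong (λ z → coord i v + z) (coordSum-─ i w∈₂)))) (assoc (coord i u) (coord i v) (coord i w) _))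
          where assoc : ∀ a b c t → a + (b + (c + t)) ≡ (a + b + c) + t
                assoc = solve-∀
        rest≈0 : ∀ {m} i → m ∣ modulus i →
          Congruence._≈_ m (coord i u + coord i v + coord i w) (coord i (σ S)) → Congruence._≈_ m (coord i (σ T)) 0ℤ
        rest≈0 {m} i m∣ uvw≈σS =
          ≈-trans (σ-coord T) (cancel-+ (≈-trans (≡⇒≈ (sym (split i))) (≈-trans (≈-sym (σ-coord S)) (≈-sym uvw≈σS))))
          where open Congruence m
                open Additive i m∣

module ReductionToSumsets where
  open import Data.Nat as ℕ using (ℕ; suc; _≤_; _∸_)
  import Data.Nat.Properties as ℕP
  open import Data.Nat.Primality using (Prime)
  open import Data.Integer using (ℤ; _+_; 0ℤ)
  open import Data.List using (List; []; _∷_; length; map; take)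
  open import Data.List.Properties using (length-map; length-take)
  open import Data.List.Membership.Propositional using (_∈_)
  open import Data.List.Membership.Propositional.Properties using (∈-map⁻; ∈-filter⁻)
  open import Data.List.Relation.Unary.Any using (here; there)
  open import Data.List.Relation.Unary.All as All using (All; []; _∷_)
  open import Data.List.Relation.Unary.AllPairs using (AllPairs; []; _∷_)
  import Data.List.Relation.Unary.AllPairs.Properties as AllPairs
  open import Data.List.Relation.Unary.Unique.Propositional using (Unique)
  import Data.List.Relation.Unary.Unique.Propositional.Properties as Unique
  open import Data.List.Relation.Binary.Sublist.Propositional using (_⊆_)
  open import Data.Nat.Properties using (_≟_)
  open import Data.Product using (_×_; _,_; Σ)
  open import Data.Product.Properties using (≡-dec)
  open import Relation.Binary.PropositionalEquality
  open import Relation.Nullary using (¬_)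
  open import Defs
  open GroupCoordinates
  open DividedDifferences using (module DividedDifference)
  open PolynomialMethod

  AllPairs-strengthen : ∀ {A : Set} {Q : A → Set} {R : A → A → Set} {L : List A} →
    AllPairs (λ u v → u ≢ v) L → All Q L → (∀ {u v} → Q u → Q v → u ≢ v → R u v) → AllPairs R L
  AllPairs-strengthen [] [] f = []
  AllPairs-strengthen (u≢ ∷ ps) (qu ∷ qs) f = All.zipWith (λ (u≢v , qv) → f qu qv u≢v) (u≢ , qs) ∷ AllPairs-strengthen ps qs f

  ∈-take⁻ : ∀ {A : Set} {x : A} n xs → x ∈ take n xs → x ∈ xs
  ∈-take⁻ (suc n) (y ∷ xs) (here e) = here e
  ∈-take⁻ (suc n) (y ∷ xs) (there x∈) = there (∈-take⁻ n xs x∈)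

  module Driver (p : ℕ) (pr : Prime p) (p≥5 : 5 ≤ p) (π : G → G) (hπ : Grp.IsProj1 p π) where
    open Grp p
    open Coordinates p pr p≥5
    open Projection π hπ

    Result : List G → Set
    Result S = Σ (List G) λ T → T ⊆ S × length T ≡ 3 ℕ.* p × σ T ≡ 0G

    fiber-member : ∀ {u x S} → u ∈ fiber π x S → u ∈ S × π u ≡ x
    fiber-member {x = x} = ∈-filter⁻ (λ g → ≡-dec _≟_ _≟_ (π g) x)

    fiber-coord : ∀ {u x S} → All (Valid p) S → u ∈ S → π u ≡ x → ∀ i → coord i u M₃.≈ coord i x
    fiber-coord vS u∈ refl i = M₃.≈-sym (π-coord i _ (All.lookup vS u∈))

    nodes : ℕ → G → List G → List ℤ
    nodes n x S = map (coord second) (take n (fiber π x S))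

    nodes-length : ∀ {n x S} → n ≤ length (fiber π x S) → length (nodes n x S) ≡ n
    nodes-length {n} {x} {S} n≤ =
      trans (length-map (coord second) (take n (fiber π x S))) (trans (length-take n (fiber π x S)) (ℕP.m≤n⇒m⊓n≡m n≤))

    nodes-origin : ∀ {a n x S} → a ∈ nodes n x S → Σ G λ u → (u ∈ S × π u ≡ x) × a ≡ coord second u
    nodes-origin {n = n} {x} {S} a∈ with ∈-map⁻ (coord second) a∈
    ... | u , u∈ , a≡ = u , fiber-member (∈-take⁻ n (fiber π x S) u∈) , a≡

    -- Distinct terms of S_x have distinct second coordinates modulo p: they already
    -- agree modulo 3, so agreeing modulo p would make them equal.
    nodes-distinct : ∀ {n x S} → All (Valid p) S → Unique S → DividedDifference.Distinct p pr (nodes n x S)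
    nodes-distinct {n} {x} {S} vS uS =
      AllPairs.map⁺ (AllPairs-strengthen (Unique.take⁺ n (Unique.filter⁺ (λ g → ≡-dec _≟_ _≟_ (π g) x) uS))
                      (All.tabulate (λ u∈ → fiber-member (∈-take⁻ n (fiber π x S) u∈)))
                      (λ (u∈ , πu) (v∈ , πv) u≢v ≈ₚ → u≢v
                        (valid-unique (All.lookup vS u∈) (All.lookup vS v∈)
                          (λ i → M₃.≈-trans (fiber-coord vS u∈ πu i) (M₃.≈-sym (fiber-coord vS v∈ πv i))) ≈ₚ)))

    -- Take k₁+1, k₂+1,
    -- k₃+1 terms of S lying over x₁, x₂, x₃, where x₁ + x₂ + x₃ = π(σ S), and a
    -- polynomial f whose non-vanishing at (u, v, w) forces u, v, w to be distinct.
    -- The restricted-sumset theorem, applied to the second coordinates, yields one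
    -- term from each group with f ≢ 0 whose second coordinates add up to that of
    -- σ(S) modulo p; removing these three terms leaves a zero-sum subsequence.
    via-sumset : ∀ S → All (Valid p) S → Unique S → length S ≡ 3 ℕ.* p ℕ.+ 3 →
      ∀ x₁ x₂ x₃ → (∀ i → coord i x₁ + coord i x₂ + coord i x₃ M₃.≈ coord i (π (σ S))) →
      ∀ k₁ k₂ k₃ → suc k₁ ≤ length (fiber π x₁ S) → suc k₂ ≤ length (fiber π x₂ S) →
      suc k₃ ≤ length (fiber π x₃ S) →
      ∀ ts → All (λ t → degree t ℕ.+ (p ∸ 1) ≡ k₁ ℕ.+ k₂ ℕ.+ k₃) ts → ¬ (leading k₁ k₂ k₃ ts Mₚ.≈ 0ℤ) →
      (∀ {u v w} → π u ≡ x₁ → π v ≡ x₂ → π w ≡ x₃ →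
         ¬ (eval ts (coord second u) (coord second v) (coord second w) Mₚ.≈ 0ℤ) → u ≢ v × u ≢ w × v ≢ w) →
      Result S
    via-sumset S vS uS len x₁ x₂ x₃ labels k₁ k₂ k₃ b₁ b₂ b₃ ts hom leading≉0 separated
      with RestrictedSumset.restricted-sumset p pr (nodes (suc k₁) x₁ S) (nodes (suc k₂) x₂ S) (nodes (suc k₃) x₃ S)
             k₁ k₂ k₃ (nodes-length {x = x₁} {S} b₁) (nodes-length {x = x₂} {S} b₂) (nodes-length {x = x₃} {S} b₃)
             (nodes-distinct {x = x₁} vS uS) (nodes-distinct {x = x₂} vS uS) (nodes-distinct {x = x₃} vS uS)
             (coord second (σ S)) ts hom leading≉0
    ... | a , a∈ , b , b∈ , c , c∈ , f≉0 , sum≈ₚ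
      with nodes-origin {x = x₁} {S} a∈ | nodes-origin {x = x₂} {S} b∈ | nodes-origin {x = x₃} {S} c∈
    ... | u , (u∈ , πu) , refl | v , (v∈ , πv) , refl | w , (w∈ , πw) , refl
      with separated πu πv πw f≉0
    ... | u≢v , u≢w , v≢w = complement-zero-sum S u∈ v∈ w∈ u≢v u≢w v≢w len sum≈₃ sum≈ₚ
      where
        sum≈₃ : ∀ i → coord i u + coord i v + coord i w M₃.≈ coord i (σ S)
        sum≈₃ i = M₃.≈-trans (M₃.+-cong (M₃.+-cong (fiber-coord vS u∈ πu i) (fiber-coord vS v∈ πv i)) (fiber-coord vS w∈ πw i))
                    (M₃.≈-trans (labels i) (π-coord i (σ S) (σ-valid S)))

-- Arithmetic choice of the sizes k₁ + 1, k₂ + 1, k₃ + 1 of the node sets.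
module ExponentChoices where
  open import Data.Nat using (ℕ; zero; suc; _+_; _*_; _∸_; _≤_; _<_; _≤?_; s≤s; s≤s⁻¹; z≤n)
  open import Data.Nat.Properties
  open import Data.Nat.Tactic.RingSolver using (solve-∀)
  open import Data.Product using (Σ; _×_; _,_)
  open import Relation.Binary.PropositionalEquality
  open import Relation.Nullary using (yes; no)

  partition₂ : ∀ N m₁ m₂ → N ≤ m₁ + m₂ → Σ ℕ λ k₁ → Σ ℕ λ k₂ → k₁ ≤ m₁ × k₂ ≤ m₂ × k₁ + k₂ ≡ N
  partition₂ N m₁ m₂ N≤ with N ≤? m₁
  ... | yes N≤m₁ = N , 0 , N≤m₁ , z≤n , +-identityʳ N
  ... | no N≰m₁ = m₁ , N ∸ m₁ , ≤-refl , m≤n+o⇒m∸n≤o N m₁ N≤ , m+[n∸m]≡n (<⇒≤ (≰⇒> N≰m₁))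

  record Exponents₁ (p n₁ n₂ n₃ : ℕ) : Set where
    constructor exponents₁
    field
      k₁ k₂ k₃ : ℕ
      k₁<n₁ : k₁ < n₁
      k₂<n₂ : k₂ < n₂
      k₃<n₃ : k₃ < n₃
      sum : k₁ + k₂ + k₃ ≡ p ∸ 1

  choose₁ : ∀ p n₁ n₂ n₃ → 1 ≤ n₁ → 1 ≤ n₂ → 1 ≤ n₃ → p + 2 ≤ n₁ + n₂ + n₃ → Exponents₁ p n₁ n₂ n₃
  choose₁ p (suc m₁) (suc m₂) (suc m₃) _ _ _ bound
    with partition₂ (p ∸ 1) m₁ (m₂ + m₃)
           (m≤n+o⇒m∸n≤o p 1 (+-cancelʳ-≤ 2 p _ (subst (p + 2 ≤_) (rearrange m₁ m₂ m₃) bound)))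
    where
      rearrange : ∀ a b c → suc a + suc b + suc c ≡ 1 + (a + (b + c)) + 2
      rearrange = solve-∀
  ... | k₁ , r , k₁≤ , r≤ , sum₁ with partition₂ r m₂ m₃ r≤
  ...   | k₂ , k₃ , k₂≤ , k₃≤ , sum₂ =
    exponents₁ k₁ k₂ k₃ (s≤s k₁≤) (s≤s k₂≤) (s≤s k₃≤) (trans (+-assoc k₁ k₂ k₃) (trans (cong (k₁ +_) sum₂) sum₁))

  record Exponents₂ (p n m : ℕ) : Set where
    constructor exponents₂
    field
      k₁ k₂ k₃ : ℕ
      k₁<n : k₁ < n
      k₂<n : k₂ < n
      k₃<m : k₃ < m
      k₂<k₁ : k₂ < k₁
      k₁<p : k₁ < p
      sum : k₁ + k₂ + k₃ ≡ p

  choose₂ : ∀ p n m → 5 ≤ p → 2 ≤ n → 1 ≤ m → p + 4 ≤ 2 * n + m → Exponents₂ p n m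
  choose₂ p (suc zero) m _ (s≤s ()) _ _
  choose₂ (suc p′) (suc (suc n′)) (suc m′) p≥5 _ _ bound with suc p′ ≤? suc n′
  -- n > p: take (p - 1, 1, 0).
  ... | yes p≤n′+1 = exponents₂ p′ 1 0 (m≤n⇒m≤1+n p≤n′+1) (s≤s (s≤s z≤n)) (s≤s z≤n)
                       (≤-trans (s≤s (s≤s z≤n)) (s≤s⁻¹ p≥5)) ≤-refl (sum p′)
    where sum : ∀ p → p + 1 + 0 ≡ suc p
          sum = solve-∀
  -- n ≤ p: take k₁ = n - 1 and split the rest between k₂ < k₁ and k₃ < m.
  ... | no p≰n′+1 with partition₂ (suc p′ ∸ suc n′) n′ m′
                         (m≤n+o⇒m∸n≤o (suc p′) (suc n′) (+-cancelʳ-≤ 4 _ _ (subst (suc p′ + 4 ≤_) (rearrange n′ m′) bound)))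
    where rearrange : ∀ a b → 2 * suc (suc a) + suc b ≡ suc a + (a + b) + 4
          rearrange = solve-∀
  ...   | k₂ , k₃ , k₂≤ , k₃≤ , sum =
    exponents₂ (suc n′) k₂ k₃ ≤-refl (s≤s (m≤n⇒m≤1+n k₂≤)) (s≤s k₃≤) (s≤s k₂≤) (≰⇒> p≰n′+1)
               (trans (+-assoc (suc n′) k₂ k₃) (trans (cong (suc n′ +_) sum) (m+[n∸m]≡n (<⇒≤ (≰⇒> p≰n′+1)))))

  record Exponents₃ (p n : ℕ) : Set where
    constructor exponents₃
    field
      k₁ k₂ k₃ : ℕ
      k₁<n : k₁ < n
      k₃<k₂ : k₃ < k₂
      k₂<k₁ : k₂ < k₁
      k₁<p : k₁ < p
      sum : k₁ + k₂ + k₃ ≡ p + 2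

  shift₃ : ∀ {p n} → Exponents₃ p n → Exponents₃ (3 + p) (suc n)
  shift₃ {p} (exponents₃ k₁ k₂ k₃ k₁<n k₃<k₂ k₂<k₁ k₁<p sum) =
    exponents₃ (suc k₁) (suc k₂) (suc k₃) (s≤s k₁<n) (s≤s k₃<k₂) (s≤s k₂<k₁) (s≤s (≤-trans k₁<p (m≤n+m p 2)))
               (trans (add3 k₁ k₂ k₃) (trans (cong (3 +_) sum) (sym (add3′ p))))
    where
      add3 : ∀ a b c → suc a + suc b + suc c ≡ 3 + (a + b + c)
      add3 = solve-∀
      add3′ : ∀ p → 3 + p + 2 ≡ 3 + (p + 2)
      add3′ = solve-∀

  choose₃ : ∀ p n → 5 ≤ p → p + 8 ≤ 3 * n → Exponents₃ p n
  choose₃ 1 n (s≤s ()) _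
  choose₃ 2 n (s≤s (s≤s ())) _
  choose₃ 3 n (s≤s (s≤s (s≤s ()))) _
  choose₃ 4 n (s≤s (s≤s (s≤s (s≤s ())))) _
  choose₃ 5 n _ bound = exponents₃ 4 2 1 (four<n bound) (≤ᵇ⇒≤ 2 2 _) (≤ᵇ⇒≤ 3 4 _) (≤ᵇ⇒≤ 5 5 _) refl
    where four<n : 13 ≤ 3 * n → 4 < n
          four<n b = *-cancelˡ-< 3 4 n (≤-trans (≤ᵇ⇒≤ 13 13 _) b)
  choose₃ 6 n _ bound = exponents₃ 4 3 1 (four<n bound) (≤ᵇ⇒≤ 2 3 _) (≤ᵇ⇒≤ 4 4 _) (≤ᵇ⇒≤ 5 6 _) refl
    where four<n : 14 ≤ 3 * n → 4 < n
          four<n b = *-cancelˡ-< 3 4 n (≤-trans (≤ᵇ⇒≤ 13 14 _) b)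
  choose₃ 7 n _ bound = exponents₃ 4 3 2 (four<n bound) (≤ᵇ⇒≤ 3 3 _) (≤ᵇ⇒≤ 4 4 _) (≤ᵇ⇒≤ 5 7 _) refl
    where four<n : 15 ≤ 3 * n → 4 < n
          four<n b = *-cancelˡ-< 3 4 n (≤-trans (≤ᵇ⇒≤ 13 15 _) b)
  choose₃ (suc (suc (suc p@(suc (suc (suc (suc (suc _)))))))) (suc n) _ bound =
    shift₃ (choose₃ p n (≤ᵇ⇒≤ 5 p _) (+-cancelˡ-≤ 3 _ _ (subst₂ _≤_ (e₁ p) (e₂ n) bound)))
    where
      e₁ : ∀ p → 3 + p + 8 ≡ 3 + (p + 8)
      e₁ = solve-∀
      e₂ : ∀ n → 3 * suc n ≡ 3 + 3 * n
      e₂ = solve-∀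

module CaseAnalysis where
  open import Data.Nat as ℕ using (ℕ; zero; suc; _≤_; _<_; _∸_; s≤s; z≤n)
  import Data.Nat.Properties as ℕP
  import Data.Nat.Divisibility as ℕD
  open import Data.Nat.Combinatorics.Base using (_P′_)
  open import Data.Nat.Primality using (Prime)
  open import Data.Integer using (ℤ; +_; _+_; _*_; -_; _-_; 0ℤ; 1ℤ)
  import Data.Integer.Properties as ℤP
  open import Data.Integer.Tactic.RingSolver using (solve-∀)
  open import Data.List using (List; []; _∷_; length)
  open import Data.List.Relation.Unary.All using (All; []; _∷_)
  open import Data.List.Relation.Unary.Unique.Propositional using (Unique)
  open import Data.Product using (_×_; _,_)
  open import Relation.Binary.PropositionalEquality
  open import Relation.Nullary using (¬_)
  open import Data.Empty using (⊥)
  open import Defs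
  open GroupCoordinates
  open PolynomialMethod
  open ExponentChoices
  open ReductionToSumsets

  P′ℤ : ℕ → ℕ → ℤ
  P′ℤ k 0 = 1ℤ
  P′ℤ k 1 = + k
  P′ℤ k 2 = + k * (+ k - 1ℤ)
  P′ℤ k e@(suc (suc (suc _))) = + (k P′ e)

  P′ℤ-correct : ∀ k e → + (k P′ e) ≡ P′ℤ k e
  P′ℤ-correct k 0 = refl
  P′ℤ-correct k 1 = cong +_ (ℕP.*-identityʳ k)
  P′ℤ-correct zero 2 = refl
  P′ℤ-correct (suc k) 2 = trans (ℤP.pos-* k (suc k ℕ.* 1))
    (trans (cong (+ k *_) (cong +_ (ℕP.*-identityʳ (suc k)))) (e (+ k)))
    where e : ∀ K → K * (1ℤ + K) ≡ (1ℤ + K) * ((1ℤ + K) - 1ℤ)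
          e = solve-∀
  P′ℤ-correct k (suc (suc (suc _))) = refl

  leadingℤ : ℕ → ℕ → ℕ → List Term → ℤ
  leadingℤ k₁ k₂ k₃ [] = 0ℤ
  leadingℤ k₁ k₂ k₃ (term s e₁ e₂ e₃ ∷ ts) = s * (P′ℤ k₁ e₁ * P′ℤ k₂ e₂ * P′ℤ k₃ e₃) + leadingℤ k₁ k₂ k₃ ts

  leading≡leadingℤ : ∀ k₁ k₂ k₃ ts → leading k₁ k₂ k₃ ts ≡ leadingℤ k₁ k₂ k₃ ts
  leading≡leadingℤ k₁ k₂ k₃ [] = refl
  leading≡leadingℤ k₁ k₂ k₃ (term s e₁ e₂ e₃ ∷ ts) =
    cong₂ (λ u v → s * u + v)
      (trans (ℤP.pos-* ((k₁ P′ e₁) ℕ.* (k₂ P′ e₂)) (k₃ P′ e₃))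
        (cong₂ _*_ (trans (ℤP.pos-* (k₁ P′ e₁) (k₂ P′ e₂)) (cong₂ _*_ (P′ℤ-correct k₁ e₁) (P′ℤ-correct k₂ e₂)))
                   (P′ℤ-correct k₃ e₃)))
      (leading≡leadingℤ k₁ k₂ k₃ ts)

  one : List Term
  one = term 1ℤ 0 0 0 ∷ []

  difference : List Term
  difference = term 1ℤ 0 1 0 ∷ term (- 1ℤ) 1 0 0 ∷ []

  vandermonde : List Term
  vandermonde = term 1ℤ 0 1 2 ∷ term (- 1ℤ) 0 2 1 ∷ term 1ℤ 1 2 0 ∷ term (- 1ℤ) 1 0 2 ∷ term 1ℤ 2 0 1 ∷ term (- 1ℤ) 2 1 0 ∷ []

  -- (The left-hand sides below are the definitional unfoldings of eval and leadingℤ.)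
  eval-difference : ∀ a b c → eval difference a b c ≡ b - a
  eval-difference a b c = e a b
    where e : ∀ a b → 1ℤ * (1ℤ * (b * 1ℤ) * 1ℤ) + (- 1ℤ * ((a * 1ℤ) * 1ℤ * 1ℤ) + 0ℤ) ≡ b - a
          e = solve-∀

  leading-difference : ∀ k₁ k₂ k₃ → leading k₁ k₂ k₃ difference ≡ + k₂ - + k₁
  leading-difference k₁ k₂ k₃ = trans (leading≡leadingℤ k₁ k₂ k₃ difference) (e (+ k₁) (+ k₂))
    where e : ∀ K₁ K₂ → 1ℤ * (1ℤ * K₂ * 1ℤ) + (- 1ℤ * (K₁ * 1ℤ * 1ℤ) + 0ℤ) ≡ K₂ - K₁
          e = solve-∀

  eval-vandermonde : ∀ a b c → eval vandermonde a b c ≡ (b - a) * (c - a) * (c - b)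
  eval-vandermonde a b c = e a b c
    where
      e : ∀ a b c →
        1ℤ * (1ℤ * (b * 1ℤ) * (c * (c * 1ℤ))) + ((- 1ℤ) * (1ℤ * (b * (b * 1ℤ)) * (c * 1ℤ)) +
        (1ℤ * ((a * 1ℤ) * (b * (b * 1ℤ)) * 1ℤ) + ((- 1ℤ) * ((a * 1ℤ) * 1ℤ * (c * (c * 1ℤ))) +
        (1ℤ * ((a * (a * 1ℤ)) * 1ℤ * (c * 1ℤ)) + ((- 1ℤ) * ((a * (a * 1ℤ)) * (b * 1ℤ) * 1ℤ) + 0ℤ)))))
        ≡ (b - a) * (c - a) * (c - b)
      e = solve-∀

  leading-vandermonde : ∀ k₁ k₂ k₃ → leading k₁ k₂ k₃ vandermonde ≡ (+ k₂ - + k₁) * (+ k₃ - + k₁) * (+ k₃ - + k₂)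
  leading-vandermonde k₁ k₂ k₃ = trans (leading≡leadingℤ k₁ k₂ k₃ vandermonde) (e (+ k₁) (+ k₂) (+ k₃))
    where
      e : ∀ K₁ K₂ K₃ →
        1ℤ * (1ℤ * K₂ * (K₃ * (K₃ - 1ℤ))) + ((- 1ℤ) * (1ℤ * (K₂ * (K₂ - 1ℤ)) * K₃) +
        (1ℤ * (K₁ * (K₂ * (K₂ - 1ℤ)) * 1ℤ) + ((- 1ℤ) * (K₁ * 1ℤ * (K₃ * (K₃ - 1ℤ))) +
        (1ℤ * ((K₁ * (K₁ - 1ℤ)) * 1ℤ * K₃) + ((- 1ℤ) * ((K₁ * (K₁ - 1ℤ)) * K₂ * 1ℤ) + 0ℤ)))))
        ≡ (K₂ - K₁) * (K₃ - K₁) * (K₃ - K₂)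
      e = solve-∀

  module Cases (p : ℕ) (pr : Prime p) (p≥5 : 5 ≤ p) (π : G → G) (hπ : Grp.IsProj1 p π) where
    open Grp p
    open Coordinates p pr p≥5
    open Driver p pr p≥5 π hπ

    apart : ∀ {u v x y} → π u ≡ x → π v ≡ y → x ≢ y → u ≢ v
    apart πu πv x≢y u≡v = x≢y (trans (sym πu) (trans (cong π u≡v) πv))

    small-≉ : ∀ {i j} → i < p → j < p → i ≢ j → ¬ (+ i - + j Mₚ.≈ 0ℤ)
    small-≉ i<p j<p i≢j d = i≢j (Mₚ.small-inj i<p j<p (Mₚ.sub≈0⇒≈ d))

    sum-labels : ∀ {g} x y z → (x ⊕ y) ⊕ z ≡ g → ∀ i → coord i x + coord i y + coord i z M₃.≈ coord i g
    sum-labels x y z hyp i = M₃.≈-sym (M₃.≈-trans (M₃.≡⇒≈ (cong (coord i) (sym hyp)))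
      (M₃.≈-trans (⊕-coord i (3∣modulus i) (x ⊕ y) z) (M₃.+-cong (⊕-coord i (3∣modulus i) x y) (M₃.≈-refl {coord i z}))))

    twice-labels : ∀ {g} x y → (2 · x) ⊕ y ≡ g → ∀ i → coord i x + coord i x + coord i y M₃.≈ coord i g
    twice-labels x y hyp i = M₃.≈-sym (M₃.≈-trans (M₃.≡⇒≈ (cong (coord i) (sym hyp)))
      (M₃.≈-trans (⊕-coord i (3∣modulus i) (2 · x) y)
      (M₃.≈-trans (M₃.+-cong (Additive.·-coord i (3∣modulus i) 2 x) (M₃.≈-refl {coord i y}))
                  (M₃.≡⇒≈ (e (coord i x) (coord i y))))))
      where e : ∀ X Y → + 2 * X + Y ≡ X + X + Y
            e = solve-∀

    thrice-labels : ∀ {g} x → 3 · x ≡ g → ∀ i → coord i x + coord i x + coord i x M₃.≈ coord i g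
    thrice-labels x hyp i = M₃.≈-sym (M₃.≈-trans (M₃.≡⇒≈ (cong (coord i) (sym hyp)))
      (M₃.≈-trans (Additive.·-coord i (3∣modulus i) 3 x) (M₃.≡⇒≈ (e (coord i x)))))
      where e : ∀ X → + 3 * X ≡ X + X + X
            e = solve-∀

    case₁ : ∀ S → All (Valid p) S → Unique S → length S ≡ 3 ℕ.* p ℕ.+ 3 → ∀ x y z → x ≢ y → x ≢ z → y ≢ z →
      (x ⊕ y) ⊕ z ≡ π (σ S) → 1 ≤ length (fiber π x S) → 1 ≤ length (fiber π y S) → 1 ≤ length (fiber π z S) →
      p ℕ.+ 2 ≤ length (fiber π x S) ℕ.+ length (fiber π y S) ℕ.+ length (fiber π z S) → Result S
    case₁ S vS uS len x y z x≢y x≢z y≢z hyp n₁≥1 n₂≥1 n₃≥1 bound =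
      via-sumset S vS uS len x y z (sum-labels x y z hyp) k₁ k₂ k₃ k₁<n₁ k₂<n₂ k₃<n₃
                 one (sym sum ∷ []) 1≉0
                 (λ πu πv πw _ → apart πu πv x≢y , apart πu πw x≢z , apart πv πw y≢z)
      where
        open Exponents₁ (choose₁ p _ _ _ n₁≥1 n₂≥1 n₃≥1 bound)
        1≉0 : ¬ (+ 1 Mₚ.≈ 0ℤ)
        1≉0 z = ℕP.<⇒≢ (ℕP.≤-trans (s≤s (s≤s z≤n)) p≥5) (sym (ℕD.∣1⇒≡1 (Mₚ.≈0⇒∣ℕ z)))

    -- Case (2): points x, x, y; f = b - a forces the two terms over x to differ.
    case₂ : ∀ S → All (Valid p) S → Unique S → length S ≡ 3 ℕ.* p ℕ.+ 3 → ∀ x y → x ≢ y →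
      (2 · x) ⊕ y ≡ π (σ S) → 2 ≤ length (fiber π x S) → 1 ≤ length (fiber π y S) →
      p ℕ.+ 4 ≤ 2 ℕ.* length (fiber π x S) ℕ.+ length (fiber π y S) → Result S
    case₂ S vS uS len x y x≢y hyp nx≥2 ny≥1 bound =
      via-sumset S vS uS len x x y (twice-labels x y hyp) k₁ k₂ k₃ k₁<n k₂<n k₃<m
                 difference (degree-ok ∷ degree-ok ∷ []) leading≉0
                 (λ {u} {v} {w} πu πv πw f≉0 → differ {u} {v} {w} f≉0 , apart πu πw x≢y , apart πv πw x≢y)
      where
        open Exponents₂ (choose₂ p _ _ p≥5 nx≥2 ny≥1 bound)
        degree-ok : 1 ℕ.+ (p ∸ 1) ≡ k₁ ℕ.+ k₂ ℕ.+ k₃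
        degree-ok = trans (ℕP.m+[n∸m]≡n (ℕP.≤-trans (s≤s z≤n) p≥5)) (sym sum)
        leading≉0 : ¬ (leading k₁ k₂ k₃ difference Mₚ.≈ 0ℤ)
        leading≉0 z = small-≉ (ℕP.<-trans k₂<k₁ k₁<p) k₁<p (ℕP.<⇒≢ k₂<k₁)
                        (Mₚ.≈-trans (Mₚ.≡⇒≈ (sym (leading-difference k₁ k₂ k₃))) z)
        differ : ∀ {u v w} → ¬ (eval difference (coord second u) (coord second v) (coord second w) Mₚ.≈ 0ℤ) → u ≢ v
        differ {u} {w = w} f≉0 refl = f≉0 (Mₚ.≡⇒≈ (trans (eval-difference (coord second u) (coord second u) (coord second w)) (ℤP.+-inverseʳ (coord second u))))

    -- Case (3): a single point x; the Vandermonde polynomial forces three distinct terms.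
    case₃ : ∀ S → All (Valid p) S → Unique S → length S ≡ 3 ℕ.* p ℕ.+ 3 → ∀ x →
      3 · x ≡ π (σ S) → 3 ≤ length (fiber π x S) → p ℕ.+ 8 ≤ 3 ℕ.* length (fiber π x S) → Result S
    case₃ S vS uS len x hyp _ bound =
      via-sumset S vS uS len x x x (thrice-labels x hyp) k₁ k₂ k₃ k₁<n k₂<n k₃<n
                 vandermonde (degree-ok ∷ degree-ok ∷ degree-ok ∷ degree-ok ∷ degree-ok ∷ degree-ok ∷ []) leading≉0
                 (λ {u} {v} {w} _ _ _ → distinct {u} {v} {w})
      where
        open Exponents₃ (choose₃ p (length (fiber π x S)) p≥5 bound)
        k₂<n : k₂ < length (fiber π x S)
        k₂<n = ℕP.<-trans k₂<k₁ k₁<n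
        k₃<n : k₃ < length (fiber π x S)
        k₃<n = ℕP.<-trans k₃<k₂ k₂<n
        k₂<p : k₂ < p
        k₂<p = ℕP.<-trans k₂<k₁ k₁<p
        k₃<p : k₃ < p
        k₃<p = ℕP.<-trans k₃<k₂ k₂<p
        degree-ok : 3 ℕ.+ (p ∸ 1) ≡ k₁ ℕ.+ k₂ ℕ.+ k₃
        degree-ok = trans (cong (2 ℕ.+_) (ℕP.m+[n∸m]≡n (ℕP.≤-trans (s≤s z≤n) p≥5))) (trans (ℕP.+-comm 2 p) (sym sum))
        leading≉0 : ¬ (leading k₁ k₂ k₃ vandermonde Mₚ.≈ 0ℤ)
        leading≉0 z =
          Mₚ.*≉0 (Mₚ.*≉0 (small-≉ k₂<p k₁<p (ℕP.<⇒≢ k₂<k₁)) (small-≉ k₃<p k₁<p (ℕP.<⇒≢ (ℕP.<-trans k₃<k₂ k₂<k₁))))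
                 (small-≉ k₃<p k₂<p (ℕP.<⇒≢ k₃<k₂))
                 (Mₚ.≈-trans (Mₚ.≡⇒≈ (sym (leading-vandermonde k₁ k₂ k₃))) z)
        distinct : ∀ {u v w} → ¬ (eval vandermonde (coord second u) (coord second v) (coord second w) Mₚ.≈ 0ℤ) →
                   u ≢ v × u ≢ w × v ≢ w
        distinct {u} {v} {w} f≉0 =
            (λ { refl → vanishes (a-a (coord second u) (coord second w)) })
          , (λ { refl → vanishes (b-b (coord second u) (coord second v)) })
          , (λ { refl → vanishes (c-c (coord second u) (coord second v)) })
          where
            vanishes : (coord second v - coord second u) * (coord second w - coord second u) * (coord second w - coord second v) ≡ 0ℤ → ⊥
            vanishes z = f≉0 (Mₚ.≡⇒≈ (trans (eval-vandermonde (coord second u) (coord second v) (coord second w)) z))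
            a-a : ∀ a c → (a - a) * (c - a) * (c - a) ≡ 0ℤ
            a-a = solve-∀
            b-b : ∀ a b → (b - a) * (a - a) * (a - b) ≡ 0ℤ
            b-b = solve-∀
            c-c : ∀ a b → (b - a) * (b - a) * (b - b) ≡ 0ℤ
            c-c = solve-∀

open import Defs
open import Data.Nat using (ℕ; _+_; _*_; _≤_)
open import Data.Nat.Primality using (Prime)
open import Data.Product using (_×_; Σ; _,_)
open import Data.Sum using (_⊎_; inj₁; inj₂)
open import Data.List using (List; length)
open import Data.List.Relation.Unary.All using (All)
open import Data.List.Relation.Unary.Unique.Propositional using (Unique)
open import Data.List.Relation.Binary.Sublist.Propositional using (_⊆_)
open import Relation.Binary.PropositionalEquality using (_≡_; _≢_)
open CaseAnalysis using (module Cases)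

lemma3p6 : (p : ℕ) → Prime p → 5 ≤ p →
    (π : G → G) → Grp.IsProj1 p π →
    (S : List G) → All (Valid p) S → Unique S → length S ≡ 3 * p + 3 →
    ( (Σ G λ x → Σ G λ y → Σ G λ z → x ≢ y × x ≢ z × y ≢ z ×
         Grp._⊕_ p (Grp._⊕_ p x y) z ≡ π (Grp.σ p S) ×
         1 ≤ length (Grp.fiber p π x S) × 1 ≤ length (Grp.fiber p π y S) ×
         1 ≤ length (Grp.fiber p π z S) ×
         p + 2 ≤ length (Grp.fiber p π x S) + length (Grp.fiber p π y S)
                   + length (Grp.fiber p π z S))
      ⊎ (Σ G λ x → Σ G λ y → x ≢ y ×
         Grp._⊕_ p (Grp._·_ p 2 x) y ≡ π (Grp.σ p S) ×
         2 ≤ length (Grp.fiber p π x S) × 1 ≤ length (Grp.fiber p π y S) ×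
         p + 4 ≤ 2 * length (Grp.fiber p π x S) + length (Grp.fiber p π y S))
      ⊎ (Σ G λ x →
         Grp._·_ p 3 x ≡ π (Grp.σ p S) ×
         3 ≤ length (Grp.fiber p π x S) ×
         p + 8 ≤ 3 * length (Grp.fiber p π x S)) ) →
    Σ (List G) λ T → T ⊆ S × length T ≡ 3 * p × Grp.σ p T ≡ 0G
lemma3p6 p pr p≥5 π hπ S vS uS len (inj₁ (x , y , z , x≢y , x≢z , y≢z , hyp , n₁ , n₂ , n₃ , bound)) =
  Cases.case₁ p pr p≥5 π hπ S vS uS len x y z x≢y x≢z y≢z hyp n₁ n₂ n₃ bound
lemma3p6 p pr p≥5 π hπ S vS uS len (inj₂ (inj₁ (x , y , x≢y , hyp , nx , ny , bound))) =
  Cases.case₂ p pr p≥5 π hπ S vS uS len x y x≢y hyp nx ny bound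
lemma3p6 p pr p≥5 π hπ S vS uS len (inj₂ (inj₂ (x , hyp , nx , bound))) =
  Cases.case₃ p pr p≥5 π hπ S vS uS len x hyp nx bound
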